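{- For every $r\ge 2$ and every $n\ge 0$, $V_n^{(r)}(x,y)=W_n^{(r)}(x,y)$; that is, $V_n^{(r)}(x,y)=\sum_{\sigma\in S_n}x^{r(\sigma)}y^{s(\sigma)}$ for $n\ge 1$.
   Context: Fix an integer $r\ge 2$ and indeterminates $x,y$. For $n\ge 1$ let $A_n^{(r)}(x,y)=(a_{i,j})_{1\le i,j\le n}$ be the $n\times n$ matrix with $a_{i,i+1}=-i$ for $1\le i\le n-1$; $a_{i,j}=x$ whenever $0\le i-j\le r-2$; $a_{i,i-r+1}=y+i-r$ for $r\le i\le n$; and all other entries $0$. Define $V_0^{(r)}(x,y)=1$ and $V_n^{(r)}(x,y)=\det A_n^{(r)}(x,y)$ for $n\ge 1$. A cycle of a permutation is $r$-regular if its length is not divisible by $r$ and $r$-singular if its length is divisible by $r$; for $\sigma\in S_n$ let $r(\sigma)$, $s(\sigma)$ be the numbers of $r$-regular and $r$-singular cycles. Set $W_0^{(r)}(x,y)=1$ and $W_n^{(r)}(x,y)=\sum_{\sigma\in S_n}x^{r(\sigma)}y^{s(\sigma)}$ for $n\ge 1$. -}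

module Defs where

open import Level using (Level)
open import Algebra.Bundles using (CommutativeRing)
open import Data.Nat as ℕ using (ℕ; zero; suc; _∸_; _≤?_)
open import Data.Nat.Divisibility using (_∣?_)
open import Data.Fin as Fin using (Fin; toℕ; punchIn)
open import Data.Fin.Properties using (all?) renaming (_≟_ to _≟F_)
open import Data.List using (List; []; _∷_; [_]; map; concatMap; filter; length; foldr)
open import Data.List.Base using () renaming (allFin to allFinL)
open import Relation.Nullary using (¬_; yes; no; Dec)
open import Relation.Nullary.Decidable using (_→-dec_; _×-dec_; ¬?)
open import Relation.Binary.PropositionalEquality using (_≡_)
open import Data.Product using (_×_)

iter : ∀ {n} → (Fin n → Fin n) → ℕ → Fin n → Fin n
iter f zero    i = i
iter f (suc k) i = f (iter f k i)

cons : ∀ {m k} → Fin k → (Fin m → Fin k) → (Fin (suc m) → Fin k)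
cons a f Fin.zero    = a
cons a f (Fin.suc i) = f i

allFns : ∀ m k → List (Fin m → Fin k)
allFns zero    k = [ (λ ()) ]
allFns (suc m) k = concatMap (λ f → map (λ a → cons a f) (allFinL k)) (allFns m k)

-- a self-map of Fin n is a permutation iff it is injective
IsPerm : ∀ {n} → (Fin n → Fin n) → Set
IsPerm {n} f = ∀ i j → f i ≡ f j → i ≡ j

isPerm? : ∀ {n} (f : Fin n → Fin n) → Dec (IsPerm f)
isPerm? f = all? (λ i → all? (λ j → (f i ≟F f j) →-dec (i ≟F j)))

perms : ∀ n → List (Fin n → Fin n)
perms n = filter isPerm? (allFns n n)

-- length of the cycle of σ through i: least k ≥ 1 with σ^k i = i
-- (search over k = 1..n; always found for permutations)
cycleLen : ∀ {n} → (Fin n → Fin n) → Fin n → ℕ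
cycleLen {n} f i = go n 1
  where
  go : ℕ → ℕ → ℕ
  go zero    k = k
  go (suc m) k with iter f k i ≟F i
  ... | yes _ = k
  ... | no  _ = go m (suc k)

IsLeader : ∀ {n} → (Fin n → Fin n) → Fin n → Set
IsLeader {n} f i = ∀ (k : Fin n) → toℕ i ℕ.≤ toℕ (iter f (toℕ k) i)

isLeader? : ∀ {n} (f : Fin n → Fin n) (i : Fin n) → Dec (IsLeader f i)
isLeader? f i = all? (λ k → toℕ i ≤? toℕ (iter f (toℕ k) i))

-- r-regular cycles: one leader per cycle, cycle length not divisible by r
regCycles : ℕ → ∀ {n} → (Fin n → Fin n) → ℕ
regCycles r {n} f =
  length (filter (λ i → isLeader? f i ×-dec ¬? (r ∣? cycleLen f i)) (allFinL n))

singCycles : ℕ → ∀ {n} → (Fin n → Fin n) → ℕ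
singCycles r {n} f =
  length (filter (λ i → isLeader? f i ×-dec (r ∣? cycleLen f i)) (allFinL n))

-- Ring-valued part: x, y range over an arbitrary commutative ring
-- (equivalently: a polynomial identity in ℤ[x,y]).

module _ {c ℓ} (R : CommutativeRing c ℓ) where
  open CommutativeRing R

  fromℕ : ℕ → Carrier
  fromℕ zero    = 0#
  fromℕ (suc n) = 1# + fromℕ n

  pow : Carrier → ℕ → Carrier
  pow a zero    = 1#
  pow a (suc k) = a * pow a k

  sumL : List Carrier → Carrier
  sumL = foldr _+_ 0#

  det : ∀ n → (Fin n → Fin n → Carrier) → Carrier
  det zero    M = 1#
  det (suc n) M = go (suc n) 1# λ j → M Fin.zero j * det n (λ a b → M (Fin.suc a) (punchIn j b))
    where
    go : ∀ m → Carrier → (Fin m → Carrier) → Carrier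
    go zero    s t = 0#
    go (suc m) s t = s * t Fin.zero + go m (- s) (λ j → t (Fin.suc j))

  -- entry (a,b) of A_n^{(r)}(x,y), with 1-based indices a, b
  entry : ℕ → Carrier → Carrier → ℕ → ℕ → Carrier
  entry r x y a b with b ℕ.≟ suc a | b ≤? a
  ... | yes _ | _     = - fromℕ a
  ... | no _  | no _  = 0#
  ... | no _  | yes _ with (a ∸ b) ≤? (r ∸ 2) | (a ∸ b) ℕ.≟ (r ∸ 1)
  ...   | yes _ | _     = x
  ...   | no _  | yes _ = y + fromℕ (a ∸ r)
  ...   | no _  | no _  = 0#

  A : ℕ → ∀ n → Carrier → Carrier → Fin n → Fin n → Carrier
  A r n x y i j = entry r x y (suc (toℕ i)) (suc (toℕ j))

  V : ℕ → ℕ → Carrier → Carrier → Carrier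
  V r n x y = det n (A r n x y)

  W : ℕ → ℕ → Carrier → Carrier → Carrier
  W r n x y = sumL (map (λ σ → pow x (regCycles r σ) * pow y (singCycles r σ)) (perms n))

{-# OPTIONS --safe #-}
-- Both sides satisfy the same recurrence.  Let w L = y if r ∣ L and x otherwise be the
-- weight of a cycle of length L.  Every permutation of {0, …, n} arises exactly once by
-- sending 0 to some p and splicing p into the cycle through 0 of a permutation of the
-- other n points; this lengthens the cycle of 0 by one and keeps all other cycles, so
--   W_{n+1} = Σ_{d ≤ n} n (n-1) ⋯ (n-d+1) · w (d+1) · W_{n-d}.
-- A_{n+1} is lower Hessenberg with superdiagonal -1, -2, …, -n, and expanding its
-- determinant gives the same sum for V with w (d+1) replaced by a_{n+1,n+1-d}, which is x
-- for d ≤ r-2, y + n+1-r for d = r-1 and 0 beyond.  As w has period r, the terms with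
-- d ≥ r-1 of the first sum add up to n (n-1) ⋯ (n-r+2) · (y + n+1-r) · W_{n+1-r}, so the
-- two recurrences agree and V_n = W_n by strong induction.
module Submission where

open import Defs
open import Algebra.Bundles using (CommutativeRing)
open import Data.Nat using (ℕ; _≤_)

open import Algebra.Bundles using (CommutativeMonoid)
import Algebra.Properties.CommutativeMonoid.Sum as CommutativeMonoidSum
open import Data.Empty using (⊥-elim)
open import Data.Fin as Fin using (Fin; zero; suc; toℕ; punchIn)
import Data.Fin.Properties as Fin
import Data.Fin.Permutation as Perm
open import Data.List using (List; []; _∷_; _++_; map; concatMap; foldr; tabulate)
open import Data.List.Base using () renaming (allFin to allFinL)
import Data.List.Properties as List
open import Data.List.Relation.Unary.All using (All; []; _∷_)
open import Data.Nat as ℕ using (zero; suc; _<_; _∸_; z≤n; s≤s)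
import Data.Nat.Properties as ℕ
open import Data.Product using (∃; _×_; _,_; proj₁; proj₂)
open import Data.Sum using (_⊎_; inj₁; inj₂)
open import Function using (_∘_; case_of_; _⇔_; mk⇔; Equivalence)
open import Relation.Binary.PropositionalEquality as ≡ using (_≡_; _≢_; _≗_)
open import Relation.Nullary using (¬_; Dec; yes; no; does)

module ListSum {a ℓ} (M : CommutativeMonoid a ℓ) where

  open CommutativeMonoid M
  open CommutativeMonoidSum M using (sum)
  open import Relation.Binary.Reasoning.Setoid setoid

  sumₗ : List Carrier → Carrier
  sumₗ = foldr _∙_ ε

  sumₗ-++ : ∀ xs ys → sumₗ (xs ++ ys) ≈ sumₗ xs ∙ sumₗ ys
  sumₗ-++ []       ys = sym (identityˡ _)
  sumₗ-++ (x ∷ xs) ys = trans (∙-congˡ (sumₗ-++ xs ys)) (sym (assoc x _ _))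

  sumₗ-map-cong : ∀ {b p} {B : Set b} {P : B → Set p} {f g : B → Carrier} →
                  (∀ {x} → P x → f x ≈ g x) → ∀ {xs} → All P xs → sumₗ (map f xs) ≈ sumₗ (map g xs)
  sumₗ-map-cong f≈g []         = refl
  sumₗ-map-cong f≈g (px ∷ pxs) = ∙-cong (f≈g px) (sumₗ-map-cong f≈g pxs)

  sumₗ-map-zero : ∀ {b p} {B : Set b} {P : B → Set p} {f : B → Carrier} →
                  (∀ {x} → P x → f x ≈ ε) → ∀ {xs} → All P xs → sumₗ (map f xs) ≈ ε
  sumₗ-map-zero f≈0 []         = refl
  sumₗ-map-zero f≈0 (px ∷ pxs) = trans (∙-cong (f≈0 px) (sumₗ-map-zero f≈0 pxs)) (identityˡ ε)

  sumₗ-concatMap : ∀ {b c} {B : Set b} {C : Set c} (g : C → Carrier) (F : B → List C) xs →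
                   sumₗ (map g (concatMap F xs)) ≈ sumₗ (map (λ x → sumₗ (map g (F x))) xs)
  sumₗ-concatMap g F []       = refl
  sumₗ-concatMap g F (x ∷ xs) = begin
    sumₗ (map g (F x ++ concatMap F xs))             ≡⟨ ≡.cong sumₗ (List.map-++ g (F x) _) ⟩
    sumₗ (map g (F x) ++ map g (concatMap F xs))     ≈⟨ sumₗ-++ (map g (F x)) _ ⟩
    sumₗ (map g (F x)) ∙ sumₗ (map g (concatMap F xs)) ≈⟨ ∙-congˡ (sumₗ-concatMap g F xs) ⟩
    sumₗ (map g (F x)) ∙ sumₗ (map (λ x → sumₗ (map g (F x))) xs) ∎

  sumₗ-tabulate : ∀ {b} {B : Set b} (g : B → Carrier) {n} (h : Fin n → B) →
                  sumₗ (map g (tabulate h)) ≡ sum (g ∘ h)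
  sumₗ-tabulate g {zero}  h = ≡.refl
  sumₗ-tabulate g {suc n} h = ≡.cong (g (h zero) ∙_) (sumₗ-tabulate g (h ∘ suc))

  sumₗ-allFin : ∀ {n} (g : Fin n → Carrier) → sumₗ (map g (allFinL n)) ≡ sum g
  sumₗ-allFin g = sumₗ-tabulate g (λ i → i)

  sumₗ-middle : ∀ xs y zs → sumₗ (xs ++ y ∷ zs) ≈ y ∙ sumₗ (xs ++ zs)
  sumₗ-middle []       y zs = refl
  sumₗ-middle (x ∷ xs) y zs = begin
    x ∙ sumₗ (xs ++ y ∷ zs)     ≈⟨ ∙-congˡ (sumₗ-middle xs y zs) ⟩
    x ∙ (y ∙ sumₗ (xs ++ zs))   ≈⟨ assoc x y _ ⟨
    (x ∙ y) ∙ sumₗ (xs ++ zs)   ≈⟨ ∙-cong (comm x y) refl ⟩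
    (y ∙ x) ∙ sumₗ (xs ++ zs)   ≈⟨ assoc y x _ ⟩
    y ∙ (x ∙ sumₗ (xs ++ zs))   ∎

  sumₗ-map-middle : ∀ {b} {B : Set b} (f : B → Carrier) xs y zs →
                    sumₗ (map f (xs ++ y ∷ zs)) ≈ f y ∙ sumₗ (map f (xs ++ zs))
  sumₗ-map-middle f xs y zs = begin
    sumₗ (map f (xs ++ y ∷ zs))               ≡⟨ ≡.cong sumₗ (List.map-++ f xs (y ∷ zs)) ⟩
    sumₗ (map f xs ++ f y ∷ map f zs)         ≈⟨ sumₗ-middle (map f xs) (f y) (map f zs) ⟩
    f y ∙ sumₗ (map f xs ++ map f zs)         ≡⟨ ≡.cong (λ t → f y ∙ sumₗ t) (List.map-++ f xs zs) ⟨
    f y ∙ sumₗ (map f (xs ++ zs))             ∎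

module Permutations where

  open import Data.Bool using (if_then_else_)
  import Data.List.Relation.Unary.All.Properties as All
  open import Data.Fin using (fromℕ<; punchOut)
  open import Data.List using (length; filter)
  open import Data.Nat using (_+_)
  open import Relation.Binary.PropositionalEquality using (refl; sym; trans; cong; cong₂; subst; module ≡-Reasoning)
  open import Relation.Nullary.Decidable using (_×-dec_; does-⇔; dec-true; dec-false)
  open import Relation.Unary using (Decidable)

  module ℕΣ = CommutativeMonoidSum ℕ.+-0-commutativeMonoid

  -- Iteration and cycle lengths

  module _ {n : ℕ} where

    iter-+ : ∀ (f : Fin n → Fin n) a b i → iter f (a + b) i ≡ iter f a (iter f b i)
    iter-+ f zero    b i = refl
    iter-+ f (suc a) b i = cong f (iter-+ f a b i)

    iter-suc : ∀ (f : Fin n → Fin n) k i → iter f (suc k) i ≡ iter f k (f i)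
    iter-suc f k i = trans (cong (λ t → iter f t i) (ℕ.+-comm 1 k)) (iter-+ f k 1 i)

    iter-cong : ∀ {f g : Fin n → Fin n} → f ≗ g → ∀ k i → iter f k i ≡ iter g k i
    iter-cong f≗g zero    i = refl
    iter-cong {f} f≗g (suc k) i = trans (cong f (iter-cong f≗g k i)) (f≗g _)

    iter-injective : ∀ {f : Fin n → Fin n} → IsPerm f → ∀ k {i j} → iter f k i ≡ iter f k j → i ≡ j
    iter-injective f-inj zero    eq = eq
    iter-injective f-inj (suc k) eq = iter-injective f-inj k (f-inj _ _ eq)

  Returns : ∀ {n} → (Fin n → Fin n) → Fin n → ℕ → Set
  Returns f i k = iter f k i ≡ i

  record IsFirstReturn {n} (f : Fin n → Fin n) (i : Fin n) (k v : ℕ) : Set where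
    field
      after   : k ≤ v
      returns : Returns f i v
      first   : ∀ {j} → k ≤ j → j < v → ¬ Returns f i j

  module _ {n} {f : Fin n → Fin n} {i : Fin n} where

    firstReturn-≤ : ∀ {k v L} → IsFirstReturn f i k v → k ≤ L → Returns f i L → v ≤ L
    firstReturn-≤ r k≤L ret = ℕ.≮⇒≥ (λ L<v → IsFirstReturn.first r k≤L L<v ret)

    firstReturn-unique : ∀ {k v v′} → IsFirstReturn f i k v → IsFirstReturn f i k v′ → v ≡ v′
    firstReturn-unique r r′ = ℕ.≤-antisym
      (firstReturn-≤ r (IsFirstReturn.after r′) (IsFirstReturn.returns r′))
      (firstReturn-≤ r′ (IsFirstReturn.after r) (IsFirstReturn.returns r))

  -- `cycleLen` searches with a loop local to its where-block, which has no name we can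
  -- refer to.  In the goal of `cycleLen-loop` that loop occurs applied to variables only, so
  -- unification solves `firstReturnFrom` as the loop itself: it tests k, k+1, …, k+m-1 in turn.
  mutual
    firstReturnFrom : ∀ {n} → (Fin n → Fin n) → Fin n → ℕ → ℕ → ℕ
    firstReturnFrom = _

    private
      cycleLen-loop : ∀ {m} (f : Fin (suc m) → Fin (suc m)) i → cycleLen f i ≡ cycleLen f i
      cycleLen-loop {m} f i with iter f 1 i Fin.≟ i
      ... | yes _ = refl
      ... | no  _ with suc m | f | i
      ...   | n′ | f′ | i′ with m | 2
      ...     | m′ | k = refl {x = firstReturnFrom {n′} f′ i′ m′ k}

  module _ {n} {f : Fin n → Fin n} {i : Fin n} where

    firstReturnFrom-isFirstReturn : ∀ m k {L} → k ≤ L → L < k + m → Returns f i L →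
                                    IsFirstReturn f i k (firstReturnFrom f i m k)
    firstReturnFrom-isFirstReturn zero k {L} k≤L L<k+0 ret = ⊥-elim (ℕ.≤⇒≯ k≤L (subst (L <_) (ℕ.+-identityʳ k) L<k+0))
    firstReturnFrom-isFirstReturn (suc m) k {L} k≤L L<k+m ret with iter f k i Fin.≟ i
    ... | yes returns = record
      { after = ℕ.≤-refl ; returns = returns ; first = λ k≤j j<k → ⊥-elim (ℕ.<-irrefl refl (ℕ.<-≤-trans j<k k≤j)) }
    ... | no ¬returns = record
      { after = ℕ.≤-trans (ℕ.n≤1+n k) (IsFirstReturn.after rest)
      ; returns = IsFirstReturn.returns rest
      ; first = first
      }
      where
      rest = firstReturnFrom-isFirstReturn m (suc k)
               (ℕ.≤∧≢⇒< k≤L (λ { refl → ¬returns ret })) (subst (L <_) (ℕ.+-suc k m) L<k+m) ret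
      first : ∀ {j} → k ≤ j → j < firstReturnFrom f i m (suc k) → ¬ Returns f i j
      first k≤j j<v with ℕ.m≤n⇒m<n∨m≡n k≤j
      ... | inj₁ k<j  = IsFirstReturn.first rest k<j j<v
      ... | inj₂ refl = ¬returns

    firstReturnFrom-cong : ∀ {g} → f ≗ g → ∀ m k → firstReturnFrom f i m k ≡ firstReturnFrom g i m k
    firstReturnFrom-cong f≗g zero k = refl
    firstReturnFrom-cong {g} f≗g (suc m) k with iter f k i Fin.≟ i | iter g k i Fin.≟ i
    ... | yes _    | yes _    = refl
    ... | yes fret | no ¬gret = ⊥-elim (¬gret (trans (sym (iter-cong f≗g k i)) fret))
    ... | no ¬fret | yes gret = ⊥-elim (¬fret (trans (iter-cong f≗g k i) gret))
    ... | no _     | no _     = firstReturnFrom-cong f≗g m (suc k)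

  module _ {n} {f : Fin n → Fin n} (f-inj : IsPerm f) (i : Fin n) where

    returns-within : ∃ λ L → 1 ≤ L × L ≤ n × Returns f i L
    returns-within with Fin.pigeonhole (ℕ.n<1+n n) (λ (k : Fin (suc n)) → iter f (toℕ k) i)
    ... | a , b , a<b , same = toℕ b ∸ toℕ a , ℕ.m<n⇒0<n∸m a<b
        , ℕ.≤-trans (ℕ.m∸n≤m (toℕ b) (toℕ a)) (ℕ.≤-pred (Fin.toℕ<n b))
        , iter-injective f-inj (toℕ a) (sym (begin
            iter f (toℕ a) i                             ≡⟨ same ⟩
            iter f (toℕ b) i                             ≡⟨ cong (λ t → iter f t i) (ℕ.m+[n∸m]≡n (ℕ.<⇒≤ a<b)) ⟨
            iter f (toℕ a + (toℕ b ∸ toℕ a)) i           ≡⟨ iter-+ f (toℕ a) _ i ⟩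
            iter f (toℕ a) (iter f (toℕ b ∸ toℕ a) i)    ∎))
      where open ≡-Reasoning

    cycleLen-isFirstReturn : IsFirstReturn f i 1 (cycleLen f i)
    cycleLen-isFirstReturn with returns-within
    ... | L , 1≤L , L≤n , ret = firstReturnFrom-isFirstReturn n 1 1≤L (s≤s L≤n) ret

    cycleLen≤n : cycleLen f i ≤ n
    cycleLen≤n with returns-within
    ... | L , 1≤L , L≤n , ret = ℕ.≤-trans (firstReturn-≤ cycleLen-isFirstReturn 1≤L ret) L≤n

    cycleLen-positive : 1 ≤ cycleLen f i
    cycleLen-positive = IsFirstReturn.after cycleLen-isFirstReturn

    cycleLen-returns : Returns f i (cycleLen f i)
    cycleLen-returns = IsFirstReturn.returns cycleLen-isFirstReturn

    cycleLen-unique : ∀ {L} → IsFirstReturn f i 1 L → cycleLen f i ≡ L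
    cycleLen-unique = firstReturn-unique cycleLen-isFirstReturn

    iter-reduce : ∀ k → ∃ λ k′ → k′ < cycleLen f i × iter f k i ≡ iter f k′ i
    iter-reduce zero = 0 , cycleLen-positive , refl
    iter-reduce (suc k) with iter-reduce k
    ... | k′ , k′<L , eq with ℕ.m≤n⇒m<n∨m≡n k′<L
    ...   | inj₁ 1+k′<L = suc k′ , 1+k′<L , cong f eq
    ...   | inj₂ 1+k′≡L = 0 , cycleLen-positive , trans (cong f eq) (subst (Returns f i) (sym 1+k′≡L) cycleLen-returns)

    leader-≤-orbit : IsLeader f i → ∀ k → toℕ i ≤ toℕ (iter f k i)
    leader-≤-orbit leader k with iter-reduce k
    ... | k′ , k′<L , eq = subst (λ j → toℕ i ≤ toℕ j) (sym (trans eq (cong (λ t → iter f t i) (sym (Fin.toℕ-fromℕ< k′<n)))))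
                                  (leader (fromℕ< k′<n))
      where k′<n = ℕ.<-≤-trans k′<L cycleLen≤n

  cycleLen-cong : ∀ {n} {f g : Fin n → Fin n} → f ≗ g → ∀ i → cycleLen f i ≡ cycleLen g i
  cycleLen-cong {n} f≗g i = firstReturnFrom-cong f≗g n 1

  isLeader-cong : ∀ {n} {f g : Fin n → Fin n} → f ≗ g → ∀ {i} → IsLeader f i → IsLeader g i
  isLeader-cong f≗g {i} leader k = subst (λ j → toℕ i ≤ toℕ j) (iter-cong f≗g (toℕ k) i) (leader k)

  isPerm-cong : ∀ {n} {f g : Fin n → Fin n} → f ≗ g → IsPerm f → IsPerm g
  isPerm-cong f≗g f-inj a b eq = f-inj a b (trans (f≗g a) (trans eq (sym (f≗g b))))

  -- Inserting 0 into a permutation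

  module _ {m : ℕ} where

    swap₀ : Fin (suc m) → Fin (suc m) → Fin (suc m)
    swap₀ p k with k Fin.≟ zero
    ... | yes _ = p
    ... | no  _ with k Fin.≟ p
    ...   | yes _ = zero
    ...   | no  _ = k

    swap₀-self : ∀ p → swap₀ p p ≡ zero
    swap₀-self p with p Fin.≟ zero
    ... | yes p≡0 = p≡0
    ... | no  _ with p Fin.≟ p
    ...   | yes _   = refl
    ...   | no  p≢p = ⊥-elim (p≢p refl)

    swap₀-other : ∀ p {k} → k ≢ zero → k ≢ p → swap₀ p k ≡ k
    swap₀-other p {k} k≢0 k≢p with k Fin.≟ zero
    ... | yes k≡0 = ⊥-elim (k≢0 k≡0)
    ... | no  _ with k Fin.≟ p
    ...   | yes k≡p = ⊥-elim (k≢p k≡p)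
    ...   | no  _   = refl

    swap₀-involutive : ∀ p k → swap₀ p (swap₀ p k) ≡ k
    swap₀-involutive p k with k Fin.≟ zero
    ... | yes refl = swap₀-self p
    ... | no  k≢0 with k Fin.≟ p
    ...   | yes refl = refl
    ...   | no  k≢p  = swap₀-other p k≢0 k≢p

    swap₀-injective : ∀ p {k l} → swap₀ p k ≡ swap₀ p l → k ≡ l
    swap₀-injective p {k} {l} eq =
      trans (sym (swap₀-involutive p k)) (trans (cong (swap₀ p) eq) (swap₀-involutive p l))

    extend : Fin (suc m) → (Fin m → Fin m) → Fin (suc m) → Fin (suc m)
    extend p τ k with p Fin.≟ k
    ... | yes _   = p
    ... | no  p≢k = punchIn p (τ (punchOut p≢k))

    extend-self : ∀ p τ → extend p τ p ≡ p
    extend-self p τ with p Fin.≟ p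
    ... | yes _   = refl
    ... | no  p≢p = ⊥-elim (p≢p refl)

    extend-punchIn : ∀ p τ j → extend p τ (punchIn p j) ≡ punchIn p (τ j)
    extend-punchIn p τ j with p Fin.≟ punchIn p j
    ... | yes p≡ = ⊥-elim (Fin.punchInᵢ≢i p j (sym p≡))
    ... | no  _  = cong (punchIn p ∘ τ) (trans (Fin.punchOut-cong p refl) (Fin.punchOut-punchIn p))

    extend-isPerm : ∀ p {τ} → IsPerm τ → IsPerm (extend p τ)
    extend-isPerm p τ-inj k l eq with p Fin.≟ k | p Fin.≟ l
    ... | yes p≡k | yes p≡l = trans (sym p≡k) p≡l
    ... | yes _   | no  _   = ⊥-elim (Fin.punchInᵢ≢i p _ (sym eq))
    ... | no  _   | yes _   = ⊥-elim (Fin.punchInᵢ≢i p _ eq)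
    ... | no  p≢k | no  p≢l = Fin.punchOut-injective p≢k p≢l (τ-inj _ _ (Fin.punchIn-injective p _ _ eq))

    -- insert₀ p τ sends 0 to p.  For p = 0 it fixes 0 and acts as τ on the rest; otherwise
    -- it splices p into the cycle of τ through 0, right after 0, and relabels every other
    -- element by the monotone map punchIn p.
    insert₀ : Fin (suc m) → (Fin m → Fin m) → Fin (suc m) → Fin (suc m)
    insert₀ p τ = extend p τ ∘ swap₀ p

    insert₀-zero : ∀ p τ → insert₀ p τ zero ≡ p
    insert₀-zero p τ = extend-self p τ

    insert₀-punchIn : ∀ p τ j → punchIn p j ≢ zero → insert₀ p τ (punchIn p j) ≡ punchIn p (τ j)
    insert₀-punchIn p τ j ≢0 =
      trans (cong (extend p τ) (swap₀-other p ≢0 (Fin.punchInᵢ≢i p j))) (extend-punchIn p τ j)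

    insert₀-isPerm : ∀ p {τ} → IsPerm τ → IsPerm (insert₀ p τ)
    insert₀-isPerm p τ-inj k l eq = swap₀-injective p (extend-isPerm p τ-inj _ _ eq)

    insert₀-cong : ∀ p {τ τ′} → τ ≗ τ′ → insert₀ p τ ≗ insert₀ p τ′
    insert₀-cong p τ≗τ′ k with p Fin.≟ swap₀ p k
    ... | yes _ = refl
    ... | no  _ = cong (punchIn p) (τ≗τ′ _)

    -- punchOut, with the junk value d when k = p
    punchOutOr : Fin m → Fin (suc m) → Fin (suc m) → Fin m
    punchOutOr d p k with p Fin.≟ k
    ... | yes _   = d
    ... | no  p≢k = punchOut p≢k

    punchOutOr-punchIn : ∀ d p j → punchOutOr d p (punchIn p j) ≡ j
    punchOutOr-punchIn d p j with p Fin.≟ punchIn p j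
    ... | yes p≡ = ⊥-elim (Fin.punchInᵢ≢i p j (sym p≡))
    ... | no  _  = trans (Fin.punchOut-cong p refl) (Fin.punchOut-punchIn p)

    punchIn-punchOutOr : ∀ d p k → p ≢ k → punchIn p (punchOutOr d p k) ≡ k
    punchIn-punchOutOr d p k p≢k with p Fin.≟ k
    ... | yes p≡k = ⊥-elim (p≢k p≡k)
    ... | no  p≢k = Fin.punchIn-punchOut p≢k

    remove₀ : (Fin (suc m) → Fin (suc m)) → Fin m → Fin m
    remove₀ σ j = punchOutOr j (σ zero) (σ (swap₀ (σ zero) (punchIn (σ zero) j)))

  insert₀-self : ∀ {m} (a : Fin (suc m)) τ → insert₀ (suc a) τ (suc a) ≡ punchIn (suc a) (τ zero)
  insert₀-self a τ = trans (cong (extend (suc a) τ) (swap₀-self (suc a))) (extend-punchIn (suc a) τ zero)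

  module _ {m : ℕ} where

    private
      remove₀-punchIn : ∀ {σ : Fin (suc m) → Fin (suc m)} → IsPerm σ → ∀ j →
                        punchIn (σ zero) (remove₀ σ j) ≡ σ (swap₀ (σ zero) (punchIn (σ zero) j))
      remove₀-punchIn {σ} σ-inj j = punchIn-punchOutOr j (σ zero) _ λ σ0≡ →
        Fin.punchInᵢ≢i (σ zero) j (trans (sym (swap₀-involutive (σ zero) _)) (cong (swap₀ (σ zero)) (sym (σ-inj _ _ σ0≡))))

    remove₀-isPerm : ∀ {σ : Fin (suc m) → Fin (suc m)} → IsPerm σ → IsPerm (remove₀ σ)
    remove₀-isPerm {σ} σ-inj j l eq = Fin.punchIn-injective (σ zero) j l (swap₀-injective (σ zero) (σ-inj _ _ (begin
      σ (swap₀ (σ zero) (punchIn (σ zero) j)) ≡⟨ remove₀-punchIn σ-inj j ⟨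
      punchIn (σ zero) (remove₀ σ j)          ≡⟨ cong (punchIn (σ zero)) eq ⟩
      punchIn (σ zero) (remove₀ σ l)          ≡⟨ remove₀-punchIn σ-inj l ⟩
      σ (swap₀ (σ zero) (punchIn (σ zero) l)) ∎)))
      where open ≡-Reasoning

    remove₀-cong : ∀ {σ σ′ : Fin (suc m) → Fin (suc m)} → σ ≗ σ′ → remove₀ σ ≗ remove₀ σ′
    remove₀-cong {σ} {σ′} σ≗σ′ j rewrite σ≗σ′ zero = cong (punchOutOr j (σ′ zero)) (σ≗σ′ _)

    remove₀-insert₀ : ∀ (p : Fin (suc m)) τ → remove₀ (insert₀ p τ) ≗ τ
    remove₀-insert₀ p τ j rewrite insert₀-zero p τ = begin
      punchOutOr j p (extend p τ (swap₀ p (swap₀ p (punchIn p j)))) ≡⟨ cong (punchOutOr j p ∘ extend p τ) (swap₀-involutive p _) ⟩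
      punchOutOr j p (extend p τ (punchIn p j))                     ≡⟨ cong (punchOutOr j p) (extend-punchIn p τ j) ⟩
      punchOutOr j p (punchIn p (τ j))                              ≡⟨ punchOutOr-punchIn j p (τ j) ⟩
      τ j                                                           ∎
      where open ≡-Reasoning

    insert₀-remove₀ : ∀ {σ : Fin (suc m) → Fin (suc m)} → IsPerm σ → insert₀ (σ zero) (remove₀ σ) ≗ σ
    insert₀-remove₀ {σ} σ-inj k with σ zero Fin.≟ swap₀ (σ zero) k
    ... | yes p≡ = begin
      σ zero                                 ≡⟨ cong σ (swap₀-self (σ zero)) ⟨
      σ (swap₀ (σ zero) (σ zero))            ≡⟨ cong (σ ∘ swap₀ (σ zero)) p≡ ⟩
      σ (swap₀ (σ zero) (swap₀ (σ zero) k))  ≡⟨ cong σ (swap₀-involutive (σ zero) k) ⟩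
      σ k                                    ∎
      where open ≡-Reasoning
    ... | no  p≢ = begin
      punchIn p (remove₀ σ (punchOut p≢))                       ≡⟨ remove₀-punchIn σ-inj _ ⟩
      σ (swap₀ p (punchIn p (punchOut p≢)))                     ≡⟨ cong (σ ∘ swap₀ p) (Fin.punchIn-punchOut p≢) ⟩
      σ (swap₀ p (swap₀ p k))                                   ≡⟨ cong σ (swap₀-involutive p k) ⟩
      σ k                                                       ∎
      where open ≡-Reasoning
            p = σ zero

  -- Cycles of insert₀ p τ

  least-witness-below : ∀ {P : ℕ → Set} → (∀ k → Dec (P k)) → ∀ K →
                        (∀ {j} → j < K → ¬ P j) ⊎ ∃ λ k₀ → P k₀ × (∀ {j} → j < k₀ → ¬ P j)
  least-witness-below P? zero = inj₁ λ ()
  least-witness-below P? (suc K) with least-witness-below P? K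
  ... | inj₂ found = inj₂ found
  ... | inj₁ none with P? K
  ...   | yes PK = inj₂ (K , PK , none)
  ...   | no ¬PK = inj₁ λ j<1+K → case ℕ.m≤n⇒m<n∨m≡n (ℕ.≤-pred j<1+K) of λ where
                     (inj₁ j<K)  → none j<K
                     (inj₂ refl) → ¬PK

  least-witness : ∀ {P : ℕ → Set} → (∀ k → Dec (P k)) → ∀ {k} → P k → ∃ λ k₀ → P k₀ × (∀ {j} → j < k₀ → ¬ P j)
  least-witness P? {k} Pk with least-witness-below P? (suc k)
  ... | inj₁ none  = ⊥-elim (none (ℕ.n<1+n k) Pk)
  ... | inj₂ found = found

  record SameCycle {m} (σ : Fin (suc m) → Fin (suc m)) (a : Fin (suc m)) (τ : Fin m → Fin m) (b : Fin m) : Set where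
    field
      leader : IsLeader σ a ⇔ IsLeader τ b
      cycleLen≡ : cycleLen σ a ≡ cycleLen τ b

  module _ {m} (p : Fin (suc m)) {τ : Fin m → Fin m} (τ-inj : IsPerm τ) where

    private
      σ = insert₀ p τ
      σ-inj = insert₀-isPerm p τ-inj

    insert₀-orbit : ∀ e K → (∀ {k} → k < K → punchIn p (iter τ k e) ≢ zero) →
                    ∀ {k} → k ≤ K → iter σ k (punchIn p e) ≡ punchIn p (iter τ k e)
    insert₀-orbit e K avoids {zero}  _     = refl
    insert₀-orbit e K avoids {suc k} 1+k≤K =
      trans (cong σ (insert₀-orbit e K avoids (ℕ.<⇒≤ 1+k≤K))) (insert₀-punchIn p τ (iter τ k e) (avoids 1+k≤K))

    insert₀-sameCycle : ∀ e → (∀ k → punchIn p (iter τ k e) ≢ zero) → SameCycle σ (punchIn p e) τ e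
    insert₀-sameCycle e avoids = record
      { leader = mk⇔ (λ leader k → Fin.punchIn-cancel-≤ p e _ (subst (λ j → punchIn p e Fin.≤ j) (orbit (toℕ k))
                                     (leader-≤-orbit σ-inj _ leader (toℕ k))))
                     (λ leader k → subst (λ j → punchIn p e Fin.≤ j) (sym (orbit (toℕ k)))
                                     (Fin.punchIn-mono-≤ p e _ (leader-≤-orbit τ-inj e leader (toℕ k))))
      ; cycleLen≡ = cycleLen-unique σ-inj _ record
          { after   = cycleLen-positive τ-inj e
          ; returns = trans (orbit (cycleLen τ e)) (cong (punchIn p) (cycleLen-returns τ-inj e))
          ; first   = λ {j} 1≤j j<L ret → IsFirstReturn.first (cycleLen-isFirstReturn τ-inj e) 1≤j j<L
                                            (Fin.punchIn-injective p _ _ (trans (sym (orbit j)) ret))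
          }
      }
      where
      orbit : ∀ k → iter σ k (punchIn p e) ≡ punchIn p (iter τ k e)
      orbit k = insert₀-orbit e k (λ {k′} _ → avoids k′) ℕ.≤-refl

  punchIn-suc≡zero : ∀ {m} (a : Fin (suc m)) {j} → punchIn (suc a) j ≡ zero → j ≡ zero
  punchIn-suc≡zero a {zero} _ = refl

  cycleLen-insert₀-zero : ∀ {m} {τ : Fin m → Fin m} → IsPerm τ → cycleLen (insert₀ zero τ) zero ≡ 1
  cycleLen-insert₀-zero {τ = τ} τ-inj = cycleLen-unique (insert₀-isPerm zero τ-inj) zero record
    { after = ℕ.≤-refl ; returns = refl ; first = λ 1≤j j<1 → ⊥-elim (ℕ.<-irrefl refl (ℕ.<-≤-trans j<1 1≤j)) }

  module _ {m} (a : Fin (suc m)) {τ : Fin (suc m) → Fin (suc m)} (τ-inj : IsPerm τ) where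

    private
      p = suc a
      σ = insert₀ p τ
      σ-inj = insert₀-isPerm p τ-inj
      L₀ = cycleLen τ zero

      τ-orbit-avoids-zero : ∀ {k} → suc k < L₀ → iter τ (suc k) zero ≢ zero
      τ-orbit-avoids-zero 1+k<L₀ = IsFirstReturn.first (cycleLen-isFirstReturn τ-inj zero) (s≤s z≤n) 1+k<L₀

      -- the cycle of 0 in σ is 0, p, followed by the cycle of 0 in τ relabelled by punchIn p
      orbit-of-p : ∀ {k} → suc k ≤ L₀ → iter σ (suc k) p ≡ punchIn p (iter τ (suc k) zero)
      orbit-of-p {k} 1+k≤L₀ = begin
        iter σ (suc k) p                  ≡⟨ iter-suc σ k p ⟩
        iter σ k (σ p)                    ≡⟨ cong (iter σ k) (insert₀-self a τ) ⟩
        iter σ k (punchIn p (τ zero))     ≡⟨ insert₀-orbit p τ-inj (τ zero) k avoids ℕ.≤-refl ⟩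
        punchIn p (iter τ k (τ zero))     ≡⟨ cong (punchIn p) (iter-suc τ k zero) ⟨
        punchIn p (iter τ (suc k) zero)   ∎
        where
        open ≡-Reasoning
        avoids : ∀ {k′} → k′ < k → punchIn p (iter τ k′ (τ zero)) ≢ zero
        avoids {k′} k′<k hit = τ-orbit-avoids-zero (ℕ.<-≤-trans (s≤s k′<k) 1+k≤L₀)
                            (trans (iter-suc τ k′ zero) (punchIn-suc≡zero a hit))

      zero-then-p : ∀ k → iter σ (suc k) zero ≡ iter σ k p
      zero-then-p k = trans (iter-suc σ k zero) (cong (iter σ k) (insert₀-zero p τ))

      p-returns-to-zero : iter σ L₀ p ≡ zero
      p-returns-to-zero with L₀ | cycleLen-positive τ-inj zero | cycleLen-returns τ-inj zero | orbit-of-p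
      ... | suc K | _ | returns | orbit = trans (orbit ℕ.≤-refl) (cong (punchIn p) returns)

    cycleLen-insert₀-suc : cycleLen σ zero ≡ suc L₀
    cycleLen-insert₀-suc = cycleLen-unique σ-inj zero record
      { after   = s≤s z≤n
      ; returns = trans (zero-then-p L₀) p-returns-to-zero
      ; first   = first
      }
      where
      first : ∀ {j} → 1 ≤ j → j < suc L₀ → iter σ j zero ≢ zero
      first {suc zero}    _ _         ret = Fin.0≢1+n (sym (trans (sym (insert₀-zero p τ)) ret))
      first {suc (suc k)} _ 2+k<2+L₀ ret = τ-orbit-avoids-zero (ℕ.≤-pred 2+k<2+L₀)
        (punchIn-suc≡zero a (trans (sym (orbit-of-p (ℕ.<⇒≤ (ℕ.≤-pred 2+k<2+L₀)))) (trans (sym (zero-then-p (suc k))) ret)))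

    insert₀-self-nonLeader : ¬ IsLeader σ p
    insert₀-self-nonLeader leader =
      ℕ.n≮0 (subst (λ j → toℕ p ≤ toℕ j) p-returns-to-zero (leader-≤-orbit σ-inj p leader L₀))

    insert₀-nonLeader : ∀ e {k} → e ≢ zero → iter τ k e ≡ zero → ¬ IsLeader σ (punchIn p e) × ¬ IsLeader τ e
    insert₀-nonLeader e {k} e≢0 hit = σ-nonLeader , τ-nonLeader
      where
      zero-least : ∀ {n} {j : Fin (suc n)} → toℕ j ≤ toℕ {suc n} zero → j ≡ zero
      zero-least {j = zero} _ = refl

      τ-nonLeader : ¬ IsLeader τ e
      τ-nonLeader leader = e≢0 (zero-least (subst (λ j → toℕ e ≤ toℕ j) hit (leader-≤-orbit τ-inj e leader k)))

      σ-nonLeader : ¬ IsLeader σ (punchIn p e)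
      σ-nonLeader leader with least-witness {P = λ k → iter τ k e ≡ zero} (λ k → iter τ k e Fin.≟ zero) {k} hit
      ... | k₀ , hit₀ , before = e≢0 (punchIn-suc≡zero a (zero-least (subst (λ j → toℕ (punchIn p e) ≤ toℕ j) σ-hit
                                                                        (leader-≤-orbit σ-inj _ leader k₀))))
        where
        σ-hit : iter σ k₀ (punchIn p e) ≡ zero
        σ-hit = trans (insert₀-orbit p τ-inj e k₀ (λ k<k₀ → before k<k₀ ∘ punchIn-suc≡zero a) ℕ.≤-refl)
                      (cong (punchIn p) hit₀)

  -- Counting cycles

  ind : ∀ {a} {A : Set a} → Dec A → ℕ
  ind a? = if does a? then 1 else 0

  ind-cong : ∀ {a b} {A : Set a} {B : Set b} → A ⇔ B → (a? : Dec A) (b? : Dec B) → ind a? ≡ ind b?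
  ind-cong A⇔B a? b? = cong (if_then 1 else 0) (does-⇔ A⇔B a? b?)

  ind-yes : ∀ {a} {A : Set a} → A → (a? : Dec A) → ind a? ≡ 1
  ind-yes a a? = cong (if_then 1 else 0) (dec-true a? a)

  ind-no : ∀ {a} {A : Set a} → ¬ A → (a? : Dec A) → ind a? ≡ 0
  ind-no ¬a a? = cong (if_then 1 else 0) (dec-false a? ¬a)

  length-filter-tabulate : ∀ {a p} {A : Set a} {P : A → Set p} (P? : Decidable P) {n} (g : Fin n → A) →
                           length (filter P? (tabulate g)) ≡ ℕΣ.sum (λ i → ind (P? (g i)))
  length-filter-tabulate P? {zero}  g = refl
  length-filter-tabulate P? {suc n} g with P? (g zero)
  ... | yes _ = cong suc (length-filter-tabulate P? (g ∘ suc))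
  ... | no  _ = length-filter-tabulate P? (g ∘ suc)

  module _ {P : ℕ → Set} (P? : Decidable P) where

    CycleStart : ∀ {n} → (Fin n → Fin n) → Fin n → Set
    CycleStart σ i = IsLeader σ i × P (cycleLen σ i)

    cycleStart? : ∀ {n} (σ : Fin n → Fin n) → Decidable (CycleStart σ)
    cycleStart? σ i = isLeader? σ i ×-dec P? (cycleLen σ i)

    countCycles : ∀ {n} → (Fin n → Fin n) → ℕ
    countCycles {n} σ = length (filter (cycleStart? σ) (allFinL n))

    countCyclesAwayFromZero : ∀ {m} → (Fin (suc m) → Fin (suc m)) → ℕ
    countCyclesAwayFromZero σ = ℕΣ.sum (λ i → ind (cycleStart? σ (suc i)))

    countCycles-sum : ∀ {n} (σ : Fin n → Fin n) → countCycles σ ≡ ℕΣ.sum (λ i → ind (cycleStart? σ i))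
    countCycles-sum σ = length-filter-tabulate (cycleStart? σ) (λ i → i)

    countCycles-split : ∀ {m} (σ : Fin (suc m) → Fin (suc m)) →
                        countCycles σ ≡ ind (P? (cycleLen σ zero)) + countCyclesAwayFromZero σ
    countCycles-split σ = trans (countCycles-sum σ)
      (cong (_+ countCyclesAwayFromZero σ) (ind-cong (mk⇔ proj₂ ((λ _ → z≤n) ,_)) (cycleStart? σ zero) (P? (cycleLen σ zero))))

    cycleStart-cong : ∀ {n} {σ σ′ : Fin n → Fin n} → σ ≗ σ′ → ∀ i → CycleStart σ i ⇔ CycleStart σ′ i
    cycleStart-cong σ≗σ′ i = mk⇔
      (λ (leader , P-len) → isLeader-cong σ≗σ′ leader , subst P (cycleLen-cong σ≗σ′ i) P-len)
      (λ (leader , P-len) → isLeader-cong (sym ∘ σ≗σ′) leader , subst P (sym (cycleLen-cong σ≗σ′ i)) P-len)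

    countCycles-cong : ∀ {n} {σ σ′ : Fin n → Fin n} → σ ≗ σ′ → countCycles σ ≡ countCycles σ′
    countCycles-cong {σ = σ} {σ′} σ≗σ′ = begin
      countCycles σ
        ≡⟨ countCycles-sum σ ⟩
      ℕΣ.sum (λ i → ind (cycleStart? σ i))
        ≡⟨ ℕΣ.sum-cong-≗ (λ i → ind-cong (cycleStart-cong σ≗σ′ i) (cycleStart? σ i) (cycleStart? σ′ i)) ⟩
      ℕΣ.sum (λ i → ind (cycleStart? σ′ i))
        ≡⟨ countCycles-sum σ′ ⟨
      countCycles σ′                            ∎
      where open ≡-Reasoning

    countCyclesAwayFromZero-cong : ∀ {m} {σ σ′ : Fin (suc m) → Fin (suc m)} → σ ≗ σ′ →
                                   countCyclesAwayFromZero σ ≡ countCyclesAwayFromZero σ′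
    countCyclesAwayFromZero-cong {σ = σ} {σ′} σ≗σ′ =
      ℕΣ.sum-cong-≗ (λ i → ind-cong (cycleStart-cong σ≗σ′ (suc i)) (cycleStart? σ (suc i)) (cycleStart? σ′ (suc i)))

    sameCycle-cycleStart : ∀ {m σ a τ b} → SameCycle {m} σ a τ b → CycleStart σ a ⇔ CycleStart τ b
    sameCycle-cycleStart same = mk⇔
      (λ (leader , P-len) → Equivalence.to (SameCycle.leader same) leader , subst P (SameCycle.cycleLen≡ same) P-len)
      (λ (leader , P-len) → Equivalence.from (SameCycle.leader same) leader , subst P (sym (SameCycle.cycleLen≡ same)) P-len)

  orbit-hits-zero? : ∀ {m} {τ : Fin (suc m) → Fin (suc m)} → IsPerm τ → ∀ e →
                     (∃ λ k → iter τ k e ≡ zero) ⊎ (∀ k → iter τ k e ≢ zero)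
  orbit-hits-zero? {m} {τ} τ-inj e with Fin.any? (λ (k : Fin (suc m)) → iter τ (toℕ k) e Fin.≟ zero)
  ... | yes (k , hit) = inj₁ (toℕ k , hit)
  ... | no  none      = inj₂ λ k hit → case iter-reduce τ-inj e k of λ where
    (k′ , k′<L , eq) → let k′<n = ℕ.<-≤-trans k′<L (cycleLen≤n τ-inj e) in
      none (fromℕ< k′<n , trans (cong (λ t → iter τ t e) (Fin.toℕ-fromℕ< k′<n)) (trans (sym eq) hit))

  module _ {P : ℕ → Set} (P? : Decidable P) where

    countCyclesAwayFromZero-insert₀-zero : ∀ {m} {τ : Fin m → Fin m} → IsPerm τ →
                                           countCyclesAwayFromZero P? (insert₀ zero τ) ≡ countCycles P? τ
    countCyclesAwayFromZero-insert₀-zero {τ = τ} τ-inj = trans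
      (ℕΣ.sum-cong-≗ λ e → ind-cong (sameCycle-cycleStart P? (insert₀-sameCycle zero τ-inj e (λ _ ())))
                                    (cycleStart? P? (insert₀ zero τ) (suc e)) (cycleStart? P? τ e))
      (sym (countCycles-sum P? τ))

    countCyclesAwayFromZero-insert₀-suc : ∀ {m} (a : Fin (suc m)) {τ : Fin (suc m) → Fin (suc m)} → IsPerm τ →
                                          countCyclesAwayFromZero P? (insert₀ (suc a) τ) ≡ countCyclesAwayFromZero P? τ
    countCyclesAwayFromZero-insert₀-suc a {τ} τ-inj = begin
      ℕΣ.sum (λ i → ind (cycleStart? P? σ (suc i)))                     ≡⟨ ℕΣ.sum-remove {i = a} (λ i → ind (cycleStart? P? σ (suc i))) ⟩
      ind (cycleStart? P? σ (suc a)) + ℕΣ.sum (λ j → ind (cycleStart? P? σ (suc (punchIn a j))))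
        ≡⟨ cong₂ _+_ (ind-no (insert₀-self-nonLeader a τ-inj ∘ proj₁) (cycleStart? P? σ (suc a)))
                     (ℕΣ.sum-cong-≗ relabel) ⟩
      ℕΣ.sum (λ j → ind (cycleStart? P? τ (suc j)))                     ∎
      where
      open ≡-Reasoning
      σ = insert₀ (suc a) τ
      relabel : ∀ j → ind (cycleStart? P? σ (suc (punchIn a j))) ≡ ind (cycleStart? P? τ (suc j))
      relabel j with orbit-hits-zero? τ-inj (suc j)
      ... | inj₁ (k , hit) = let (σ-nonLeader , τ-nonLeader) = insert₀-nonLeader a τ-inj (suc j) {k} (λ ()) hit in
        trans (ind-no (σ-nonLeader ∘ proj₁) (cycleStart? P? σ (suc (punchIn a j))))
              (sym (ind-no (τ-nonLeader ∘ proj₁) (cycleStart? P? τ (suc j))))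
      ... | inj₂ avoids = ind-cong
        (sameCycle-cycleStart P? (insert₀-sameCycle (suc a) τ-inj (suc j) (λ k → avoids k ∘ punchIn-suc≡zero a)))
        (cycleStart? P? σ (suc (punchIn a j))) (cycleStart? P? τ (suc j))

  -- Enumerating permutations

  sum-single : ∀ {n} (c : Fin n) (t : Fin n → ℕ) → (∀ i → i ≢ c → t i ≡ 0) → ℕΣ.sum t ≡ t c
  sum-single {suc n} c t vanish = begin
    ℕΣ.sum t                                ≡⟨ ℕΣ.sum-remove {i = c} t ⟩
    t c + ℕΣ.sum (t ∘ punchIn c)            ≡⟨ cong (t c +_) (ℕΣ.sum-cong-≗ (λ j → vanish _ (Fin.punchInᵢ≢i c j))) ⟩
    t c + ℕΣ.sum {n} (λ _ → 0)              ≡⟨ cong (t c +_) (ℕΣ.sum-replicate-zero n) ⟩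
    t c + 0                                 ≡⟨ ℕ.+-identityʳ (t c) ⟩
    t c                                     ∎
    where open ≡-Reasoning

  infix 4 _≗?_
  _≗?_ : ∀ {a b} (f g : Fin a → Fin b) → Dec (f ≗ g)
  f ≗? g = Fin.all? (λ i → f i Fin.≟ g i)

  open ListSum ℕ.+-0-commutativeMonoid using ()
    renaming (sumₗ to sumℕ; sumₗ-map-cong to sumℕ-map-cong; sumₗ-map-zero to sumℕ-map-zero;
              sumₗ-concatMap to sumℕ-concatMap; sumₗ-allFin to sumℕ-allFin; sumₗ-map-middle to sumℕ-map-middle)

  multiplicity : ∀ {a b} → List (Fin a → Fin b) → (Fin a → Fin b) → ℕ
  multiplicity fs z = sumℕ (map (λ f → ind (f ≗? z)) fs)

  multiplicity-map : ∀ {A : Set} {a b} (h : A → Fin a → Fin b) xs z →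
                     multiplicity (map h xs) z ≡ sumℕ (map (λ x → ind (h x ≗? z)) xs)
  multiplicity-map h xs z = cong sumℕ (sym (List.map-∘ xs))

  multiplicity-allFns : ∀ m k (z : Fin m → Fin k) → multiplicity (allFns m k) z ≡ 1
  multiplicity-allFns zero    k z = ind-yes (λ ()) ((λ ()) ≗? z)
  multiplicity-allFns (suc m) k z = begin
    multiplicity (allFns (suc m) k) z
      ≡⟨ sumℕ-concatMap _ (λ f → map (λ a → cons a f) (allFinL k)) (allFns m k) ⟩
    sumℕ (map (λ f → multiplicity (map (λ a → cons a f) (allFinL k)) z) (allFns m k))
      ≡⟨ cong sumℕ (List.map-cong first-value (allFns m k)) ⟩
    multiplicity (allFns m k) (z ∘ suc)
      ≡⟨ multiplicity-allFns m k (z ∘ suc) ⟩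
    1 ∎
    where
    open ≡-Reasoning
    cons≗ : ∀ {f} → f ≗ z ∘ suc → cons (z zero) f ≗ z
    cons≗ eq zero    = refl
    cons≗ eq (suc i) = eq i
    first-value : ∀ (f : Fin m → Fin k) → multiplicity (map (λ a → cons a f) (allFinL k)) z ≡ ind (f ≗? z ∘ suc)
    first-value f = begin
      multiplicity (map (λ a → cons a f) (allFinL k)) z  ≡⟨ multiplicity-map (λ a → cons a f) (allFinL k) z ⟩
      sumℕ (map (λ a → ind (cons a f ≗? z)) (allFinL k)) ≡⟨ sumℕ-allFin (λ a → ind (cons a f ≗? z)) ⟩
      ℕΣ.sum (λ a → ind (cons a f ≗? z))                 ≡⟨ sum-single (z zero) _ (λ a a≢ → ind-no (λ eq → a≢ (eq zero)) (cons a f ≗? z)) ⟩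
      ind (cons (z zero) f ≗? z)                         ≡⟨ ind-cong (mk⇔ (_∘ suc) cons≗) (cons (z zero) f ≗? z) (f ≗? z ∘ suc) ⟩
      ind (f ≗? z ∘ suc)                                 ∎

  multiplicity-filter-isPerm : ∀ {n} {z : Fin n → Fin n} → IsPerm z → ∀ fs →
                               multiplicity (filter isPerm? fs) z ≡ multiplicity fs z
  multiplicity-filter-isPerm z-inj []       = refl
  multiplicity-filter-isPerm {z = z} z-inj (f ∷ fs) with isPerm? f
  ... | yes f-inj = trans (cong (λ gs → multiplicity gs z) (List.filter-accept isPerm? f-inj))
                          (cong (ind (f ≗? z) +_) (multiplicity-filter-isPerm z-inj fs))
  ... | no  ¬perm = trans (cong (λ gs → multiplicity gs z) (List.filter-reject isPerm? ¬perm))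
                          (trans (multiplicity-filter-isPerm z-inj fs)
                                 (cong (_+ multiplicity fs z) (sym (ind-no (λ f≗z → ¬perm (isPerm-cong (sym ∘ f≗z) z-inj)) (f ≗? z)))))

  multiplicity-filter-¬isPerm : ∀ {n} {z : Fin n → Fin n} → ¬ IsPerm z → ∀ fs →
                                multiplicity (filter isPerm? fs) z ≡ 0
  multiplicity-filter-¬isPerm {z = z} ¬perm fs =
    sumℕ-map-zero (λ {f} f-inj → ind-no (λ f≗z → ¬perm (isPerm-cong f≗z f-inj)) (f ≗? z)) (All.all-filter isPerm? fs)

  multiplicity-perms : ∀ n (z : Fin n → Fin n) → multiplicity (perms n) z ≡ ind (isPerm? z)
  multiplicity-perms n z with isPerm? z
  ... | yes z-inj = trans (multiplicity-filter-isPerm z-inj (allFns n n))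
                          (trans (multiplicity-allFns n n z) (sym (ind-yes z-inj (isPerm? z))))
  ... | no  ¬perm = trans (multiplicity-filter-¬isPerm ¬perm (allFns n n)) (sym (ind-no ¬perm (isPerm? z)))

  perms-isPerm : ∀ n → All IsPerm (perms n)
  perms-isPerm n = All.all-filter isPerm? (allFns n n)

  insertions : ∀ m → List (Fin (suc m) → Fin (suc m))
  insertions m = concatMap (λ p → map (insert₀ p) (perms m)) (allFinL (suc m))

  insert₀≗⇔≗remove₀ : ∀ {m} {σ : Fin (suc m) → Fin (suc m)} → IsPerm σ → ∀ τ → insert₀ (σ zero) τ ≗ σ ⇔ τ ≗ remove₀ σ
  insert₀≗⇔≗remove₀ {σ = σ} σ-inj τ = mk⇔
    (λ eq j → trans (sym (remove₀-insert₀ (σ zero) τ j)) (remove₀-cong eq j))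
    (λ eq k → trans (insert₀-cong (σ zero) eq k) (insert₀-remove₀ σ-inj k))

  multiplicity-insertions : ∀ m (z : Fin (suc m) → Fin (suc m)) → multiplicity (insertions m) z ≡ ind (isPerm? z)
  multiplicity-insertions m z = begin
    multiplicity (insertions m) z
      ≡⟨ sumℕ-concatMap _ (λ p → map (insert₀ p) (perms m)) (allFinL (suc m)) ⟩
    sumℕ (map (λ p → multiplicity (map (insert₀ p) (perms m)) z) (allFinL (suc m)))
      ≡⟨ sumℕ-allFin (λ p → multiplicity (map (insert₀ p) (perms m)) z) ⟩
    ℕΣ.sum (λ p → multiplicity (map (insert₀ p) (perms m)) z)
      ≡⟨ count (isPerm? z) ⟩
    ind (isPerm? z) ∎
    where
    open ≡-Reasoning
    count : (z? : Dec (IsPerm z)) → ℕΣ.sum (λ p → multiplicity (map (insert₀ p) (perms m)) z) ≡ ind z?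
    count (yes z-inj) = begin
      ℕΣ.sum (λ p → multiplicity (map (insert₀ p) (perms m)) z)
        ≡⟨ sum-single (z zero) _ (λ p p≢ → trans (multiplicity-map (insert₀ p) (perms m) z)
             (sumℕ-map-zero (λ {τ} _ → ind-no (λ eq → p≢ (trans (sym (insert₀-zero p τ)) (eq zero))) (insert₀ p τ ≗? z))
                            (perms-isPerm m))) ⟩
      multiplicity (map (insert₀ (z zero)) (perms m)) z
        ≡⟨ multiplicity-map (insert₀ (z zero)) (perms m) z ⟩
      sumℕ (map (λ τ → ind (insert₀ (z zero) τ ≗? z)) (perms m))
        ≡⟨ sumℕ-map-cong (λ {τ} _ → ind-cong (insert₀≗⇔≗remove₀ z-inj τ) (insert₀ (z zero) τ ≗? z) (τ ≗? remove₀ z))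
                         (perms-isPerm m) ⟩
      multiplicity (perms m) (remove₀ z)
        ≡⟨ multiplicity-perms m (remove₀ z) ⟩
      ind (isPerm? (remove₀ z))
        ≡⟨ ind-yes (remove₀-isPerm z-inj) (isPerm? (remove₀ z)) ⟩
      1 ∎
    count (no ¬perm) = trans (ℕΣ.sum-cong-≗ λ p → trans (multiplicity-map (insert₀ p) (perms m) z)
      (sumℕ-map-zero (λ {τ} τ-inj → ind-no (λ eq → ¬perm (isPerm-cong eq (insert₀-isPerm p τ-inj))) (insert₀ p τ ≗? z))
                     (perms-isPerm m)))
      (ℕΣ.sum-replicate-zero (suc m))

  record Occurrence {a b} (gs : List (Fin a → Fin b)) (f : Fin a → Fin b) : Set where
    field
      before after : List (Fin a → Fin b)
      found        : Fin a → Fin b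
      split        : gs ≡ before ++ found ∷ after
      found≗f      : found ≗ f

  occurrence : ∀ {a b} gs (f : Fin a → Fin b) → multiplicity gs f ≢ 0 → Occurrence gs f
  occurrence []       f m≢0 = ⊥-elim (m≢0 refl)
  occurrence (g ∷ gs) f m≢0 with g ≗? f
  ... | yes g≗f = record { before = [] ; after = gs ; found = g ; split = refl ; found≗f = g≗f }
  ... | no  ¬g≗f = record
    { before = g ∷ before ; after = after ; found = found ; split = cong (g ∷_) split ; found≗f = found≗f }
    where open Occurrence (occurrence gs f (m≢0 ∘ trans (cong (_+ multiplicity gs f) (ind-no ¬g≗f (g ≗? f)))))

  module _ {c ℓ} (M : CommutativeMonoid c ℓ) where

    open CommutativeMonoid M using (Carrier; _≈_; _∙_; ∙-cong; reflexive) renaming (refl to ≈-refl; sym to ≈-sym; trans to ≈-trans)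
    open ListSum M using (sumₗ; sumₗ-map-middle; sumₗ-concatMap; sumₗ-allFin)
    open CommutativeMonoidSum M using (sum)

    sumₗ-reindex : ∀ {a b} {G : (Fin a → Fin b) → Carrier} → (∀ {f g} → f ≗ g → G f ≈ G g) →
                   ∀ fs gs → (∀ z → multiplicity fs z ≡ multiplicity gs z) → sumₗ (map G fs) ≈ sumₗ (map G gs)
    sumₗ-reindex G-cong []       []       _    = ≈-refl
    sumₗ-reindex G-cong []       (g ∷ gs) same =
      ⊥-elim (ℕ.0≢1+n (trans (same g) (cong (_+ multiplicity gs g) (ind-yes (λ _ → refl) (g ≗? g)))))
    sumₗ-reindex {G = G} G-cong (f ∷ fs) gs same = ≈-trans
      (∙-cong (G-cong (sym ∘ found≗f)) (sumₗ-reindex G-cong fs (before ++ after) rest))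
      (≈-trans (≈-sym (sumₗ-map-middle G before found after)) (reflexive (cong (sumₗ ∘ map G) (sym split))))
      where
      f-occurs : multiplicity gs f ≢ 0
      f-occurs m≡0 = ℕ.0≢1+n (trans (sym m≡0) (trans (sym (same f)) (cong (_+ multiplicity fs f) (ind-yes (λ _ → refl) (f ≗? f)))))
      open Occurrence (occurrence gs f f-occurs)
      rest : ∀ z → multiplicity fs z ≡ multiplicity (before ++ after) z
      rest z = ℕ.+-cancelˡ-≡ (ind (f ≗? z)) _ _ (begin
        ind (f ≗? z) + multiplicity fs z                      ≡⟨ same z ⟩
        multiplicity gs z                                     ≡⟨ cong (λ hs → multiplicity hs z) split ⟩
        multiplicity (before ++ found ∷ after) z              ≡⟨ sumℕ-map-middle _ before found after ⟩
        ind (found ≗? z) + multiplicity (before ++ after) z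
          ≡⟨ cong (_+ multiplicity (before ++ after) z) (ind-cong found≗z⇔f≗z (found ≗? z) (f ≗? z)) ⟩
        ind (f ≗? z) + multiplicity (before ++ after) z       ∎)
        where
        open ≡-Reasoning
        found≗z⇔f≗z : found ≗ z ⇔ f ≗ z
        found≗z⇔f≗z = mk⇔ (λ eq i → trans (sym (found≗f i)) (eq i)) (λ eq i → trans (found≗f i) (eq i))

    sumₗ-perms-insert₀ : ∀ {m} {G : (Fin (suc m) → Fin (suc m)) → Carrier} → (∀ {f g} → f ≗ g → G f ≈ G g) →
                         sumₗ (map G (perms (suc m))) ≈ sum (λ p → sumₗ (map (G ∘ insert₀ p) (perms m)))
    sumₗ-perms-insert₀ {m} {G} G-cong = begin
      sumₗ (map G (perms (suc m)))
        ≈⟨ sumₗ-reindex G-cong (perms (suc m)) (insertions m)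
             (λ z → trans (multiplicity-perms (suc m) z) (sym (multiplicity-insertions m z))) ⟩
      sumₗ (map G (insertions m))
        ≈⟨ sumₗ-concatMap G (λ p → map (insert₀ p) (perms m)) (allFinL (suc m)) ⟩
      sumₗ (map (λ p → sumₗ (map G (map (insert₀ p) (perms m)))) (allFinL (suc m)))
        ≡⟨ sumₗ-allFin (λ p → sumₗ (map G (map (insert₀ p) (perms m)))) ⟩
      sum (λ p → sumₗ (map G (map (insert₀ p) (perms m))))
        ≡⟨ CommutativeMonoidSum.sum-cong-≗ M {suc m} (λ p → cong sumₗ (sym (List.map-∘ {g = G} {f = insert₀ p} (perms m)))) ⟩
      sum (λ p → sumₗ (map (G ∘ insert₀ p) (perms m)))  ∎
      where open import Relation.Binary.Reasoning.Setoid (CommutativeMonoid.setoid M)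

open Permutations
open import Data.Bool using (if_then_else_)
open import Data.Nat.Divisibility using (_∣_; _∣?_)
open import Relation.Nullary.Decidable using (¬?)
open import Relation.Unary using (Decidable)

-- Falling-factorial sums

module _ {c ℓ} (R : CommutativeRing c ℓ) where

  open CommutativeRing R hiding (zero)
  open import Relation.Binary.Reasoning.Setoid setoid
  open import Algebra.Properties.Semiring.Sum semiring using (sum; sum-cong-≋; *-distribˡ-sum)
  open import Algebra.Solver.Ring.NaturalCoefficients.Default commutativeSemiring using (solve; _:*_; _:=_)

  -- fallingSum U g n = Σ_{d ≤ n} g d · n (n-1) ⋯ (n-d+1) · U (n-d)
  fallingSum : (ℕ → Carrier) → (ℕ → Carrier) → ℕ → Carrier
  fallingSum U g zero    = g 0 * U 0
  fallingSum U g (suc n) = g 0 * U (suc n) + fromℕ R (suc n) * fallingSum U (g ∘ suc) n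

  rising : ℕ → ℕ → Carrier
  rising k zero    = 1#
  rising k (suc m) = fromℕ R (suc k) * rising (suc k) m

  rising-suc : ∀ k m → rising k (suc m) ≈ rising k m * fromℕ R (suc (k ℕ.+ m))
  rising-suc k zero    = trans (*-comm _ _) (*-congˡ (reflexive (≡.cong (fromℕ R ∘ suc) (≡.sym (ℕ.+-identityʳ k)))))
  rising-suc k (suc m) = begin
    fromℕ R (suc k) * rising (suc k) (suc m)                         ≈⟨ *-congˡ (rising-suc (suc k) m) ⟩
    fromℕ R (suc k) * (rising (suc k) m * fromℕ R (suc (suc k ℕ.+ m))) ≈⟨ *-assoc _ _ _ ⟨
    rising k (suc m) * fromℕ R (suc (suc k ℕ.+ m))                   ≡⟨ ≡.cong (λ t → rising k (suc m) * fromℕ R (suc t)) (ℕ.+-suc k m) ⟨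
    rising k (suc m) * fromℕ R (suc (k ℕ.+ suc m))                   ∎

  fallingSum-closed : ∀ U g N → fallingSum U g N ≈
                      sum (λ (d : Fin (suc N)) → g (toℕ d) * rising (N ∸ toℕ d) (toℕ d) * U (N ∸ toℕ d))
  fallingSum-closed U g zero    = sym (trans (+-identityʳ _) (*-congʳ (*-identityʳ _)))
  fallingSum-closed U g (suc N) = +-cong (*-congʳ (sym (*-identityʳ _))) (begin
    fromℕ R (suc N) * fallingSum U (g ∘ suc) N
      ≈⟨ *-congˡ (fallingSum-closed U (g ∘ suc) N) ⟩
    fromℕ R (suc N) * sum (λ (d : Fin (suc N)) → g (suc (toℕ d)) * rising (N ∸ toℕ d) (toℕ d) * U (N ∸ toℕ d))
      ≈⟨ *-distribˡ-sum {suc N} (fromℕ R (suc N)) (λ d → g (suc (toℕ d)) * rising (N ∸ toℕ d) (toℕ d) * U (N ∸ toℕ d)) ⟩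
    sum (λ (d : Fin (suc N)) → fromℕ R (suc N) * (g (suc (toℕ d)) * rising (N ∸ toℕ d) (toℕ d) * U (N ∸ toℕ d)))
      ≈⟨ sum-cong-≋ {suc N} step ⟩
    sum (λ (d : Fin (suc N)) → g (suc (toℕ d)) * rising (N ∸ toℕ d) (suc (toℕ d)) * U (N ∸ toℕ d)) ∎)
    where
    step : ∀ (d : Fin (suc N)) → fromℕ R (suc N) * (g (suc (toℕ d)) * rising (N ∸ toℕ d) (toℕ d) * U (N ∸ toℕ d)) ≈
                                 g (suc (toℕ d)) * rising (N ∸ toℕ d) (suc (toℕ d)) * U (N ∸ toℕ d)
    step d = begin
      fromℕ R (suc N) * (g (suc (toℕ d)) * rising (N ∸ toℕ d) (toℕ d) * U (N ∸ toℕ d))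
        ≈⟨ solve 4 (λ n a ρ u → n :* (a :* ρ :* u) := a :* (ρ :* n) :* u) refl _ _ _ _ ⟩
      g (suc (toℕ d)) * (rising (N ∸ toℕ d) (toℕ d) * fromℕ R (suc N)) * U (N ∸ toℕ d)
        ≡⟨ ≡.cong (λ t → g (suc (toℕ d)) * (rising (N ∸ toℕ d) (toℕ d) * fromℕ R (suc t)) * U (N ∸ toℕ d))
                  (ℕ.m∸n+n≡m (ℕ.≤-pred (Fin.toℕ<n d))) ⟨
      g (suc (toℕ d)) * (rising (N ∸ toℕ d) (toℕ d) * fromℕ R (suc (N ∸ toℕ d ℕ.+ toℕ d))) * U (N ∸ toℕ d)
        ≈⟨ *-congʳ (*-congˡ (rising-suc (N ∸ toℕ d) (toℕ d))) ⟨
      g (suc (toℕ d)) * rising (N ∸ toℕ d) (suc (toℕ d)) * U (N ∸ toℕ d) ∎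

  fallingSum-cong : ∀ n {U U′ g g′ : ℕ → Carrier} → (∀ k → k ≤ n → U k ≈ U′ k) → (∀ d → d ≤ n → g d ≈ g′ d) →
                    fallingSum U g n ≈ fallingSum U′ g′ n
  fallingSum-cong zero    U≈U′ g≈g′ = *-cong (g≈g′ 0 z≤n) (U≈U′ 0 z≤n)
  fallingSum-cong (suc n) U≈U′ g≈g′ = +-cong (*-cong (g≈g′ 0 z≤n) (U≈U′ (suc n) ℕ.≤-refl))
    (*-congˡ (fallingSum-cong n (λ k k≤n → U≈U′ k (ℕ.m≤n⇒m≤1+n k≤n)) (λ d d≤n → g≈g′ (suc d) (s≤s d≤n))))

  fallingSum-zero : ∀ n U {g : ℕ → Carrier} → (∀ d → d ≤ n → g d ≈ 0#) → fallingSum U g n ≈ 0#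
  fallingSum-zero zero    U g≈0 = trans (*-congʳ (g≈0 0 z≤n)) (zeroˡ _)
  fallingSum-zero (suc n) U g≈0 = trans (+-cong (trans (*-congʳ (g≈0 0 z≤n)) (zeroˡ _))
    (trans (*-congˡ (fallingSum-zero n U (λ d d≤n → g≈0 (suc d) (s≤s d≤n)))) (zeroʳ _))) (+-identityˡ 0#)

-- The recurrence for W

module _ {c ℓ} (R : CommutativeRing c ℓ) where

  open CommutativeRing R hiding (zero)
  open import Relation.Binary.Reasoning.Setoid setoid
  open ListSum +-commutativeMonoid using (sumₗ; sumₗ-map-cong)
  open import Algebra.Properties.Semiring.Sum semiring using (sum; sum-cong-≋)
  open import Algebra.Solver.Ring.NaturalCoefficients.Default commutativeSemiring using (solve; _:*_; _:=_)

  sum-const : ∀ n v → sum {n} (λ _ → v) ≈ fromℕ R n * v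
  sum-const zero    v = sym (zeroˡ v)
  sum-const (suc n) v = begin
    v + sum {n} (λ _ → v)     ≈⟨ +-cong (sym (*-identityˡ v)) (sum-const n v) ⟩
    1# * v + fromℕ R n * v    ≈⟨ distribʳ v 1# (fromℕ R n) ⟨
    (1# + fromℕ R n) * v      ∎

  *-distribˡ-sumₗ : ∀ {a} {A : Set a} c (f : A → Carrier) xs → c * sumₗ (map f xs) ≈ sumₗ (map (λ x → c * f x) xs)
  *-distribˡ-sumₗ c f []       = zeroʳ c
  *-distribˡ-sumₗ c f (x ∷ xs) = trans (distribˡ c (f x) _) (+-congˡ (*-distribˡ-sumₗ c f xs))

  module _ (r : ℕ) (x y : Carrier) where

    regular? : Decidable (λ L → ¬ r ∣ L)
    regular? L = ¬? (r ∣? L)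

    singular? : Decidable (r ∣_)
    singular? = r ∣?_

    cycleWeight : ℕ → Carrier
    cycleWeight L = if does (r ∣? L) then y else x

    monomial : ℕ → ℕ → Carrier
    monomial i j = pow R x i * pow R y j

    weight : ∀ {n} → (Fin n → Fin n) → Carrier
    weight σ = monomial (regCycles r σ) (singCycles r σ)

    -- 0 is the leader of its cycle, so these count the cycles avoiding 0
    restWeight : ∀ {m} → (Fin (suc m) → Fin (suc m)) → Carrier
    restWeight σ = monomial (countCyclesAwayFromZero regular? σ) (countCyclesAwayFromZero singular? σ)

    weight-split : ∀ {m} (σ : Fin (suc m) → Fin (suc m)) → weight σ ≈ cycleWeight (cycleLen σ zero) * restWeight σ
    weight-split σ = begin
      weight σ
        ≡⟨ ≡.cong₂ monomial (countCycles-split regular? σ) (countCycles-split singular? σ) ⟩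
      monomial (ind (¬? (r ∣? L)) ℕ.+ i) (ind (r ∣? L) ℕ.+ j)
        ≈⟨ split (r ∣? L) ⟩
      cycleWeight L * restWeight σ ∎
      where
      L = cycleLen σ zero
      i = countCyclesAwayFromZero regular? σ
      j = countCyclesAwayFromZero singular? σ
      split : (r∣?L : Dec (r ∣ L)) → monomial (ind (¬? r∣?L) ℕ.+ i) (ind r∣?L ℕ.+ j) ≈ (if does r∣?L then y else x) * monomial i j
      split (yes _) = solve 3 (λ p y q → p :* (y :* q) := y :* (p :* q)) refl (pow R x i) y (pow R y j)
      split (no  _) = *-assoc x (pow R x i) (pow R y j)

    restWeight-cong : ∀ {m} {σ σ′ : Fin (suc m) → Fin (suc m)} → σ ≗ σ′ → restWeight σ ≈ restWeight σ′
    restWeight-cong σ≗σ′ = reflexive (≡.cong₂ monomial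
      (countCyclesAwayFromZero-cong regular? σ≗σ′) (countCyclesAwayFromZero-cong singular? σ≗σ′))

    restWeight-insert₀-zero : ∀ {m} {τ : Fin m → Fin m} → IsPerm τ → restWeight (insert₀ zero τ) ≈ weight τ
    restWeight-insert₀-zero τ-inj = reflexive (≡.cong₂ monomial
      (countCyclesAwayFromZero-insert₀-zero regular? τ-inj) (countCyclesAwayFromZero-insert₀-zero singular? τ-inj))

    restWeight-insert₀-suc : ∀ {m} (a : Fin (suc m)) {τ : Fin (suc m) → Fin (suc m)} → IsPerm τ →
                             restWeight (insert₀ (suc a) τ) ≈ restWeight τ
    restWeight-insert₀-suc a τ-inj = reflexive (≡.cong₂ monomial
      (countCyclesAwayFromZero-insert₀-suc regular? a τ-inj) (countCyclesAwayFromZero-insert₀-suc singular? a τ-inj))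

    rootedWeight : (ℕ → Carrier) → ∀ {m} → (Fin (suc m) → Fin (suc m)) → Carrier
    rootedWeight g σ = g (cycleLen σ zero) * restWeight σ

    rootedWeight-cong : ∀ g {m} {σ σ′ : Fin (suc m) → Fin (suc m)} → σ ≗ σ′ → rootedWeight g σ ≈ rootedWeight g σ′
    rootedWeight-cong g σ≗σ′ = *-cong (reflexive (≡.cong g (cycleLen-cong σ≗σ′ zero))) (restWeight-cong σ≗σ′)

    rootedSum : ℕ → (ℕ → Carrier) → Carrier
    rootedSum m g = sumₗ (map (rootedWeight g) (perms (suc m)))

    W-suc-rootedSum : ∀ m → W R r (suc m) x y ≈ rootedSum m cycleWeight
    W-suc-rootedSum m = sumₗ-map-cong (λ {σ} _ → weight-split σ) (perms-isPerm (suc m))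

    rootedSum-insert₀ : ∀ m g → rootedSum m g ≈
                        g 1 * W R r m x y + sum (λ a → sumₗ (map (rootedWeight g ∘ insert₀ (suc a)) (perms m)))
    rootedSum-insert₀ m g = begin
      rootedSum m g
        ≈⟨ sumₗ-perms-insert₀ +-commutativeMonoid {m} (rootedWeight-cong g) ⟩
      sumₗ (map (rootedWeight g ∘ insert₀ zero) (perms m)) + sum (λ a → sumₗ (map (rootedWeight g ∘ insert₀ (suc a)) (perms m)))
        ≈⟨ +-congʳ (sumₗ-map-cong fixed (perms-isPerm m)) ⟩
      sumₗ (map (λ τ → g 1 * weight τ) (perms m)) + sum (λ a → sumₗ (map (rootedWeight g ∘ insert₀ (suc a)) (perms m)))
        ≈⟨ +-congʳ (*-distribˡ-sumₗ (g 1) weight (perms m)) ⟨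
      g 1 * W R r m x y + sum (λ a → sumₗ (map (rootedWeight g ∘ insert₀ (suc a)) (perms m))) ∎
      where
      fixed : ∀ {τ : Fin m → Fin m} → IsPerm τ → rootedWeight g (insert₀ zero τ) ≈ g 1 * weight τ
      fixed τ-inj = *-cong (reflexive (≡.cong g (cycleLen-insert₀-zero τ-inj))) (restWeight-insert₀-zero τ-inj)

    rootedSum-fallingSum : ∀ m g → rootedSum m g ≈ fallingSum R (λ k → W R r k x y) (g ∘ suc) m
    rootedSum-fallingSum zero    g = trans (rootedSum-insert₀ zero g) (+-identityʳ _)
    rootedSum-fallingSum (suc m) g = begin
      rootedSum (suc m) g
        ≈⟨ rootedSum-insert₀ (suc m) g ⟩
      g 1 * W R r (suc m) x y + sum (λ a → sumₗ (map (rootedWeight g ∘ insert₀ (suc a)) (perms (suc m))))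
        ≈⟨ +-congˡ (sum-cong-≋ (λ a → sumₗ-map-cong (moved a) (perms-isPerm (suc m)))) ⟩
      g 1 * W R r (suc m) x y + sum {suc m} (λ _ → rootedSum m (g ∘ suc))
        ≈⟨ +-congˡ (sum-const (suc m) (rootedSum m (g ∘ suc))) ⟩
      g 1 * W R r (suc m) x y + fromℕ R (suc m) * rootedSum m (g ∘ suc)
        ≈⟨ +-congˡ (*-congˡ (rootedSum-fallingSum m (g ∘ suc))) ⟩
      fallingSum R (λ k → W R r k x y) (g ∘ suc) (suc m) ∎
      where
      moved : ∀ a {τ} → IsPerm τ → rootedWeight g (insert₀ (suc a) τ) ≈ rootedWeight (g ∘ suc) τ
      moved a τ-inj = *-cong (reflexive (≡.cong g (cycleLen-insert₀-suc a τ-inj))) (restWeight-insert₀-suc a τ-inj)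

-- Lower Hessenberg determinants

module _ {c ℓ} (R : CommutativeRing c ℓ) where

  open CommutativeRing R hiding (zero)
  open import Relation.Binary.Reasoning.Setoid setoid
  open import Algebra.Properties.Ring ring using (-‿distribˡ-*; -1*x≈-x)
  open import Algebra.Properties.Semiring.Sum semiring using (sum; sum-cong-≋; *-distribˡ-sum; ∑-distrib-+)
  open import Algebra.Solver.Ring.NaturalCoefficients.Default commutativeSemiring using (solve; _:+_; _:*_; _:=_; con)

  -- `det` expands along the first row through an alternating-sum loop local to its
  -- where-block.  As for `cycleLen`, unification names that loop: `det-loopₙ` exposes it at
  -- the length used by det, and `det-loop` one step later at an independent length m.
  mutual
    alternatingSum : ∀ {n} → (Fin (suc n) → Fin (suc n) → Carrier) → (m : ℕ) → Carrier → (Fin m → Carrier) → Carrier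
    alternatingSum = _

    private
      alternatingSumₙ : ∀ {n} → (Fin (suc n) → Fin (suc n) → Carrier) → Carrier → (Fin n → Carrier) → Carrier
      alternatingSumₙ = _

      det-loopₙ : ∀ {n} (M : Fin (suc n) → Fin (suc n) → Carrier) → det R (suc n) M ≡ det R (suc n) M
      det-loopₙ {n} M with - 1# | (λ (j : Fin n) → M zero (suc j) * det R n (λ a b → M (suc a) (punchIn (suc j) b)))
      ... | s | t = ≡.refl {x = 1# * (M zero zero * det R n (λ a b → M (suc a) (suc b))) + alternatingSumₙ M s t}

      det-loop : ∀ {n} (M : Fin (suc (suc n)) → Fin (suc (suc n)) → Carrier) s t →
                 alternatingSumₙ M s t ≡ alternatingSumₙ M s t
      det-loop {n} M s t with t zero | (λ (j : Fin n) → t (suc j))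
      ... | t₀ | t′ with suc n | M
      ...   | n′ | M′ with - s | n | t′
      ...     | s′ | m | t″ = ≡.refl {x = s * t₀ + alternatingSum {n′} M′ m s′ t″}

  alternatingSum-cong : ∀ {n n′} (M : Fin (suc n) → Fin (suc n) → Carrier) (M′ : Fin (suc n′) → Fin (suc n′) → Carrier) m
                        {s s′} {t t′ : Fin m → Carrier} → s ≈ s′ → (∀ j → t j ≈ t′ j) →
                        alternatingSum M m s t ≈ alternatingSum M′ m s′ t′
  alternatingSum-cong M M′ zero    s≈s′ t≈t′ = refl
  alternatingSum-cong M M′ (suc m) s≈s′ t≈t′ =
    +-cong (*-cong s≈s′ (t≈t′ zero)) (alternatingSum-cong M M′ m (-‿cong s≈s′) (t≈t′ ∘ suc))

  alternatingSum-zero : ∀ {n} (M : Fin (suc n) → Fin (suc n) → Carrier) m s {t : Fin m → Carrier} →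
                        (∀ j → t j ≈ 0#) → alternatingSum M m s t ≈ 0#
  alternatingSum-zero M zero    s t≈0 = refl
  alternatingSum-zero M (suc m) s t≈0 =
    trans (+-cong (trans (*-congˡ (t≈0 zero)) (zeroʳ s)) (alternatingSum-zero M m (- s) (t≈0 ∘ suc))) (+-identityˡ 0#)

  det-cong : ∀ n {M M′ : Fin n → Fin n → Carrier} → (∀ a b → M a b ≈ M′ a b) → det R n M ≈ det R n M′
  det-cong zero    M≈M′ = refl
  det-cong (suc n) {M} {M′} M≈M′ = alternatingSum-cong M M′ (suc n) refl
    (λ j → *-cong (M≈M′ zero j) (det-cong n (λ a b → M≈M′ (suc a) (punchIn j b))))

  leading : ℕ → (ℕ → ℕ → Carrier) → Carrier
  leading n F = det R n (λ a b → F (toℕ a) (toℕ b))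

  delete₀₀ delete₀₁ : (ℕ → ℕ → Carrier) → ℕ → ℕ → Carrier
  delete₀₀ F i j = F (suc i) (suc j)
  delete₀₁ F i zero    = F (suc i) zero
  delete₀₁ F i (suc j) = F (suc i) (suc (suc j))

  leading-one : ∀ F → leading 1 F ≈ F 0 0
  leading-one F = trans (+-identityʳ _) (trans (*-identityˡ _) (*-identityʳ _))

  leading-laplace : ∀ n F → (∀ j → F 0 (suc (suc j)) ≈ 0#) →
                    leading (suc (suc n)) F ≈ F 0 0 * leading (suc n) (delete₀₀ F) + (- F 0 1) * leading (suc n) (delete₀₁ F)
  leading-laplace n F row₀ = begin
    1# * (F 0 0 * leading (suc n) (delete₀₀ F)) + ((- 1#) * (F 0 1 * det R (suc n) minor₁) + alternatingSum M n (- (- 1#)) rest)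
      ≈⟨ +-cong (*-identityˡ _) (+-cong (trans (-1*x≈-x _) (-‿distribˡ-* _ _)) (alternatingSum-zero M n _ rest≈0)) ⟩
    F 0 0 * leading (suc n) (delete₀₀ F) + ((- F 0 1) * det R (suc n) minor₁ + 0#)
      ≈⟨ +-congˡ (trans (+-identityʳ _) (*-congˡ (det-cong (suc n) minor₁≈))) ⟩
    F 0 0 * leading (suc n) (delete₀₀ F) + (- F 0 1) * leading (suc n) (delete₀₁ F) ∎
    where
    M = λ (a b : Fin (suc (suc n))) → F (toℕ a) (toℕ b)
    minor₁ = λ (a b : Fin (suc n)) → M (suc a) (punchIn (suc zero) b)
    minor₁≈ : ∀ a b → minor₁ a b ≈ delete₀₁ F (toℕ a) (toℕ b)
    minor₁≈ a zero    = refl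
    minor₁≈ a (suc b) = refl
    rest = λ (j : Fin n) → M zero (suc (suc j)) * det R (suc n) (λ a b → M (suc a) (punchIn (suc (suc j)) b))
    rest≈0 : ∀ j → rest j ≈ 0#
    rest≈0 j = trans (*-congʳ (row₀ (toℕ j))) (zeroˡ _)

  IsLowerHessenberg : (ℕ → ℕ → Carrier) → Set ℓ
  IsLowerHessenberg F = ∀ i j → suc i < j → F i j ≈ 0#

  superdiagonal : (ℕ → ℕ → Carrier) → ℕ → ℕ → Carrier
  superdiagonal F k zero    = 1#
  superdiagonal F k (suc m) = (- F k (suc k)) * superdiagonal F (suc k) m

  hessenbergCoefficient : (ℕ → ℕ → Carrier) → ℕ → ℕ → Carrier
  hessenbergCoefficient F n k = F n k * superdiagonal F k (n ∸ k)

  private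
    superdiagonal-delete₀₀ : ∀ F k m → superdiagonal (delete₀₀ F) k m ≡ superdiagonal F (suc k) m
    superdiagonal-delete₀₀ F k zero    = ≡.refl
    superdiagonal-delete₀₀ F k (suc m) = ≡.cong (_ *_) (superdiagonal-delete₀₀ F (suc k) m)

    superdiagonal-delete₀₁ : ∀ F k m → superdiagonal (delete₀₁ F) k m ≡ superdiagonal F (suc k) m
    superdiagonal-delete₀₁ F k zero    = ≡.refl
    superdiagonal-delete₀₁ F k (suc m) = ≡.cong (_ *_) (superdiagonal-delete₀₁ F (suc k) m)

    sum-linear : ∀ {n} (a X Y : Fin n → Carrier) u v →
                 sum (λ k → a k * (u * X k + v * Y k)) ≈ u * sum (λ k → a k * X k) + v * sum (λ k → a k * Y k)
    sum-linear a X Y u v = begin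
      sum (λ k → a k * (u * X k + v * Y k))
        ≈⟨ sum-cong-≋ (λ k → solve 5 (λ a x y u v → a :* (u :* x :+ v :* y) := u :* (a :* x) :+ v :* (a :* y))
                                     refl (a k) (X k) (Y k) u v) ⟩
      sum (λ k → u * (a k * X k) + v * (a k * Y k))
        ≈⟨ ∑-distrib-+ (λ k → u * (a k * X k)) (λ k → v * (a k * Y k)) ⟩
      sum (λ k → u * (a k * X k)) + sum (λ k → v * (a k * Y k))
        ≈⟨ +-cong (*-distribˡ-sum u (λ k → a k * X k)) (*-distribˡ-sum v (λ k → a k * Y k)) ⟨
      u * sum (λ k → a k * X k) + v * sum (λ k → a k * Y k) ∎

  delete₀₀-lowerHessenberg : ∀ {F} → IsLowerHessenberg F → IsLowerHessenberg (delete₀₀ F)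
  delete₀₀-lowerHessenberg hess i j 1+i<j = hess (suc i) (suc j) (s≤s 1+i<j)

  delete₀₁-lowerHessenberg : ∀ {F} → IsLowerHessenberg F → IsLowerHessenberg (delete₀₁ F)
  delete₀₁-lowerHessenberg hess i (suc j) (s≤s 1+i<1+j) = hess (suc i) (suc (suc j)) (s≤s (s≤s 1+i<1+j))

  hessenbergCoefficient-delete₀₀ : ∀ F n k → hessenbergCoefficient (delete₀₀ F) n k ≡ hessenbergCoefficient F (suc n) (suc k)
  hessenbergCoefficient-delete₀₀ F n k = ≡.cong (F (suc n) (suc k) *_) (superdiagonal-delete₀₀ F k (n ∸ k))

  hessenbergCoefficient-delete₀₁ : ∀ F n k →
                                   hessenbergCoefficient (delete₀₁ F) n (suc k) ≡ hessenbergCoefficient F (suc n) (suc (suc k))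
  hessenbergCoefficient-delete₀₁ F n k = ≡.cong (F (suc n) (suc (suc k)) *_) (superdiagonal-delete₀₁ F (suc k) (n ∸ suc k))

  hessenbergCoefficient-corner : ∀ F n → (- F 0 1) * hessenbergCoefficient (delete₀₁ F) n 0 ≈ hessenbergCoefficient F (suc n) 0
  hessenbergCoefficient-corner F n = begin
    (- F 0 1) * (F (suc n) 0 * superdiagonal (delete₀₁ F) 0 n) ≡⟨ ≡.cong (λ t → (- F 0 1) * (F (suc n) 0 * t)) (superdiagonal-delete₀₁ F 0 n) ⟩
    (- F 0 1) * (F (suc n) 0 * superdiagonal F 1 n)            ≈⟨ solve 3 (λ v f s → v :* (f :* s) := f :* (v :* s)) refl _ _ _ ⟩
    F (suc n) 0 * ((- F 0 1) * superdiagonal F 1 n)            ∎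

  hessenberg-expansion : ∀ n F → IsLowerHessenberg F →
                         leading (suc n) F ≈ sum (λ (k : Fin (suc n)) → hessenbergCoefficient F n (toℕ k) * leading (toℕ k) F)
  hessenberg-expansion zero    F hess = trans (leading-one F) (sym (trans (+-identityʳ _) (trans (*-identityʳ _) (*-identityʳ _))))
  hessenberg-expansion (suc n) F hess = begin
    leading (suc (suc n)) F
      ≈⟨ leading-laplace n F row₀ ⟩
    u * leading (suc n) F₀ + v * leading (suc n) F₁
      ≈⟨ +-cong (*-congˡ (trans (hessenberg-expansion n F₀ (delete₀₀-lowerHessenberg hess))
                                (sum-cong-≋ {suc n} λ k → *-congʳ {leading (toℕ k) F₀} (reflexive (hessenbergCoefficient-delete₀₀ F n (toℕ k))))))
                (*-congˡ (trans (hessenberg-expansion n F₁ (delete₀₁-lowerHessenberg hess))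
                                (+-congˡ (sum-cong-≋ {n} λ k → *-congʳ {leading (suc (toℕ k)) F₁} (reflexive (hessenbergCoefficient-delete₀₁ F n (toℕ k))))))) ⟩
    u * (a zero * 1# + S₀) + v * (P * 1# + S₁)
      ≈⟨ solve 6 (λ u v a P S₀ S₁ → u :* (a :* con 1 :+ S₀) :+ v :* (P :* con 1 :+ S₁) :=
                                   (v :* P) :* con 1 :+ (a :* u :+ (u :* S₀ :+ v :* S₁))) refl u v (a zero) P S₀ S₁ ⟩
    (v * P) * 1# + (a zero * u + (u * S₀ + v * S₁))
      ≈⟨ +-cong (*-congʳ (hessenbergCoefficient-corner F n)) (+-cong (*-congˡ (sym (leading-one F))) (sym (trans (sum-cong-≋ expand)
           (sum-linear (a ∘ suc) (λ k → leading (suc (toℕ k)) F₀) (λ k → leading (suc (toℕ k)) F₁) u v)))) ⟩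
    hessenbergCoefficient F (suc n) 0 * 1# + (a zero * leading 1 F + sum (λ k → a (suc k) * leading (suc (suc (toℕ k))) F)) ∎
    where
    F₀ = delete₀₀ F
    F₁ = delete₀₁ F
    u = F 0 0
    v = - F 0 1
    a : Fin (suc n) → Carrier
    a k = hessenbergCoefficient F (suc n) (suc (toℕ k))
    P = hessenbergCoefficient F₁ n 0
    S₀ = sum (λ (k : Fin n) → a (suc k) * leading (suc (toℕ k)) F₀)
    S₁ = sum (λ (k : Fin n) → a (suc k) * leading (suc (toℕ k)) F₁)
    row₀ : ∀ j → F 0 (suc (suc j)) ≈ 0#
    row₀ j = hess 0 (suc (suc j)) (s≤s (s≤s z≤n))
    expand : ∀ (k : Fin n) → a (suc k) * leading (suc (suc (toℕ k))) F ≈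
                             a (suc k) * (u * leading (suc (toℕ k)) F₀ + v * leading (suc (toℕ k)) F₁)
    expand k = *-congˡ (leading-laplace (toℕ k) F row₀)

-- The recurrence for V, and the theorem

module _ {c ℓ} (R : CommutativeRing c ℓ) (r′ : ℕ) (x y : CommutativeRing.Carrier R) where

  open CommutativeRing R hiding (zero)
  open import Relation.Binary.Reasoning.Setoid setoid
  open import Algebra.Properties.Ring ring using (-‿involutive)
  open import Algebra.Properties.Semiring.Sum semiring using (sum; sum-cong-≋; sum-permute)
  open import Data.Nat.Divisibility using (∣⇒≤; ∣-refl; ∣m∣n⇒∣m+n; ∣m+n∣m⇒∣n)
  open import Data.Nat.Induction using (<-rec)
  open import Relation.Nullary.Decidable using (does-⇔; dec-true; dec-false)

  -- with r = r′ + 2 the truncated differences r ∸ 2 and r ∸ 1 in `entry` compute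
  private
    r : ℕ
    r = suc (suc r′)

  entry-super : ∀ a → entry R r x y a (suc a) ≡ - fromℕ R a
  entry-super a with suc a ℕ.≟ suc a
  ... | yes _ = ≡.refl
  ... | no  ¬refl = ⊥-elim (¬refl ≡.refl)

  entry-above : ∀ a b → suc a < b → entry R r x y a b ≡ 0#
  entry-above a b 1+a<b with b ℕ.≟ suc a | b ℕ.≤? a
  ... | yes b≡1+a | _     = ⊥-elim (ℕ.<-irrefl (≡.sym b≡1+a) 1+a<b)
  ... | no  _     | yes b≤a = ⊥-elim (ℕ.≤⇒≯ b≤a (ℕ.<-trans (ℕ.n<1+n a) 1+a<b))
  ... | no  _     | no  _ = ≡.refl

  entry-band : ∀ a b → b ≤ a → a ∸ b ≤ r′ → entry R r x y a b ≡ x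
  entry-band a b b≤a d≤r′ with b ℕ.≟ suc a | b ℕ.≤? a
  ... | yes b≡1+a | _     = ⊥-elim (ℕ.<-irrefl b≡1+a (s≤s b≤a))
  ... | no  _     | no b≰a = ⊥-elim (b≰a b≤a)
  ... | no  _     | yes _ with (a ∸ b) ℕ.≤? r′ | (a ∸ b) ℕ.≟ suc r′
  ...   | yes _ | _ = ≡.refl
  ...   | no  d≰r′ | _ = ⊥-elim (d≰r′ d≤r′)

  entry-edge : ∀ a b → b ≤ a → a ∸ b ≡ suc r′ → entry R r x y a b ≡ y + fromℕ R (a ∸ r)
  entry-edge a b b≤a d≡ with b ℕ.≟ suc a | b ℕ.≤? a
  ... | yes b≡1+a | _     = ⊥-elim (ℕ.<-irrefl b≡1+a (s≤s b≤a))
  ... | no  _     | no b≰a = ⊥-elim (b≰a b≤a)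
  ... | no  _     | yes _ with (a ∸ b) ℕ.≤? r′ | (a ∸ b) ℕ.≟ suc r′
  ...   | yes d≤r′ | _     = ⊥-elim (ℕ.<-irrefl ≡.refl (≡.subst (_≤ r′) d≡ d≤r′))
  ...   | no  _    | yes _ = ≡.refl
  ...   | no  _    | no d≢  = ⊥-elim (d≢ d≡)

  entry-outside : ∀ a b → b ≤ a → suc r′ < a ∸ b → entry R r x y a b ≡ 0#
  entry-outside a b b≤a r<d with b ℕ.≟ suc a | b ℕ.≤? a
  ... | yes b≡1+a | _     = ⊥-elim (ℕ.<-irrefl b≡1+a (s≤s b≤a))
  ... | no  _     | no b≰a = ⊥-elim (b≰a b≤a)
  ... | no  _     | yes _ with (a ∸ b) ℕ.≤? r′ | (a ∸ b) ℕ.≟ suc r′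
  ...   | yes d≤r′ | _     = ⊥-elim (ℕ.≤⇒≯ (ℕ.m≤n⇒m≤1+n d≤r′) r<d)
  ...   | no  _    | yes d≡ = ⊥-elim (ℕ.<-irrefl (≡.sym d≡) r<d)
  ...   | no  _    | no  _ = ≡.refl

  -- A_n^{(r)} is the leading n × n block of the 0-indexed infinite matrix A∞
  A∞ : ℕ → ℕ → Carrier
  A∞ i j = entry R r x y (suc i) (suc j)

  A∞-lowerHessenberg : IsLowerHessenberg R A∞
  A∞-lowerHessenberg i j 1+i<j = reflexive (entry-above (suc i) (suc j) (s≤s 1+i<j))

  superdiagonal-A∞ : ∀ k m → superdiagonal R A∞ k m ≈ rising R k m
  superdiagonal-A∞ k zero    = refl
  superdiagonal-A∞ k (suc m) =
    *-cong (trans (-‿cong (reflexive (entry-super (suc k)))) (-‿involutive _)) (superdiagonal-A∞ (suc k) m)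

  -- a_{N+1,N+1-d}, the coefficient of V_{N-d} in the recurrence for V_{N+1}
  coefficient : ℕ → ℕ → Carrier
  coefficient N d = A∞ N (N ∸ d)

  V-suc-fallingSum : ∀ N → V R r (suc N) x y ≈ fallingSum R (λ k → V R r k x y) (coefficient N) N
  V-suc-fallingSum N = begin
    leading R (suc N) A∞
      ≈⟨ hessenberg-expansion R N A∞ A∞-lowerHessenberg ⟩
    sum (λ (k : Fin (suc N)) → hessenbergCoefficient R A∞ N (toℕ k) * leading R (toℕ k) A∞)
      ≈⟨ sum-permute {suc N} (λ k → hessenbergCoefficient R A∞ N (toℕ k) * leading R (toℕ k) A∞) Perm.reverse ⟩
    sum (λ (d : Fin (suc N)) → hessenbergCoefficient R A∞ N (toℕ (Fin.opposite d)) * leading R (toℕ (Fin.opposite d)) A∞)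
      ≈⟨ sum-cong-≋ reindexed ⟩
    sum (λ (d : Fin (suc N)) → coefficient N (toℕ d) * rising R (N ∸ toℕ d) (toℕ d) * V R r (N ∸ toℕ d) x y)
      ≈⟨ fallingSum-closed R (λ k → V R r k x y) (coefficient N) N ⟨
    fallingSum R (λ k → V R r k x y) (coefficient N) N ∎
    where
    reindexed : ∀ (d : Fin (suc N)) →
                hessenbergCoefficient R A∞ N (toℕ (Fin.opposite d)) * leading R (toℕ (Fin.opposite d)) A∞ ≈
                coefficient N (toℕ d) * rising R (N ∸ toℕ d) (toℕ d) * V R r (N ∸ toℕ d) x y
    reindexed d rewrite Fin.opposite-prop d = *-congʳ (*-congˡ (trans (superdiagonal-A∞ (N ∸ toℕ d) (N ∸ (N ∸ toℕ d)))
      (reflexive (≡.cong (rising R (N ∸ toℕ d)) (ℕ.m∸[m∸n]≡n (ℕ.≤-pred (Fin.toℕ<n d)))))))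

  coefficient-band : ∀ N d → d ≤ N → d ≤ r′ → coefficient N d ≡ x
  coefficient-band N d d≤N d≤r′ = entry-band (suc N) (suc (N ∸ d)) (s≤s (ℕ.m∸n≤m N d))
    (≡.subst (_≤ r′) (≡.sym (ℕ.m∸[m∸n]≡n d≤N)) d≤r′)

  coefficient-edge : ∀ n → coefficient (suc r′ ℕ.+ n) (suc r′) ≡ y + fromℕ R n
  coefficient-edge n = ≡.trans (entry-edge (suc N) (suc (N ∸ suc r′)) (s≤s (ℕ.m∸n≤m N (suc r′))) (ℕ.m∸[m∸n]≡n r′<N))
                               (≡.cong (λ k → y + fromℕ R k) (ℕ.m+n∸m≡n (suc r′) n))
    where
    N = suc r′ ℕ.+ n
    r′<N = ℕ.m≤m+n (suc r′) n

  coefficient-outside : ∀ N d → d ≤ N → suc r′ < d → coefficient N d ≡ 0#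
  coefficient-outside N d d≤N r′<d = entry-outside (suc N) (suc (N ∸ d)) (s≤s (ℕ.m∸n≤m N d))
    (≡.subst (suc r′ <_) (≡.sym (ℕ.m∸[m∸n]≡n d≤N)) r′<d)

  cycleWeight-short : ∀ L → L < suc r′ → cycleWeight R r x y (suc L) ≡ x
  cycleWeight-short L L<1+r′ = ≡.cong (if_then y else x) (dec-false (r ∣? suc L) (λ r∣1+L → ℕ.<⇒≱ (s≤s L<1+r′) (∣⇒≤ r∣1+L)))

  cycleWeight-r : cycleWeight R r x y r ≡ y
  cycleWeight-r = ≡.cong (if_then y else x) (dec-true (r ∣? r) ∣-refl)

  cycleWeight-periodic : ∀ L → cycleWeight R r x y (L ℕ.+ r) ≡ cycleWeight R r x y L
  cycleWeight-periodic L = ≡.cong (if_then y else x) (does-⇔ (mk⇔ r∣L+r⇒r∣L (λ r∣L → ∣m∣n⇒∣m+n r∣L ∣-refl)) (r ∣? L ℕ.+ r) (r ∣? L))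
    where
    r∣L+r⇒r∣L : r ∣ L ℕ.+ r → r ∣ L
    r∣L+r⇒r∣L r∣L+r = ∣m+n∣m⇒∣n (≡.subst (r ∣_) (ℕ.+-comm L r) r∣L+r) ∣-refl

  private
    W′ : ℕ → Carrier
    W′ k = W R r k x y

    w : ℕ → Carrier
    w d = cycleWeight R r x y (suc d)

  W-suc-fallingSum : ∀ m → W′ (suc m) ≈ fallingSum R W′ w m
  W-suc-fallingSum m = trans (W-suc-rootedSum R r x y m) (rootedSum-fallingSum R r x y m (cycleWeight R r x y))

  fallingSum-tail : ∀ n → fallingSum R W′ (λ d → w (d ℕ.+ suc r′)) n ≈ (y + fromℕ R n) * W′ n
  fallingSum-tail zero    = *-cong (trans (reflexive cycleWeight-r) (sym (+-identityʳ y))) refl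
  fallingSum-tail (suc n) = begin
    w (suc r′) * W′ (suc n) + fromℕ R (suc n) * fallingSum R W′ (λ d → w (suc d ℕ.+ suc r′)) n
      ≈⟨ +-cong (*-congʳ (reflexive cycleWeight-r))
                (*-congˡ (trans (fallingSum-cong R n (λ _ _ → refl) (λ d _ → reflexive (periodic d))) (sym (W-suc-fallingSum n)))) ⟩
    y * W′ (suc n) + fromℕ R (suc n) * W′ (suc n)
      ≈⟨ distribʳ _ _ _ ⟨
    (y + fromℕ R (suc n)) * W′ (suc n) ∎
    where
    periodic : ∀ d → w (suc d ℕ.+ suc r′) ≡ w d
    periodic d = ≡.trans (≡.cong (cycleWeight R r x y ∘ suc) (≡.sym (ℕ.+-suc d (suc r′)))) (cycleWeight-periodic (suc d))

  coefficient-tail : ∀ n → fallingSum R W′ (λ d → coefficient (suc r′ ℕ.+ n) (d ℕ.+ suc r′)) n ≈ (y + fromℕ R n) * W′ n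
  coefficient-tail zero    = *-congʳ (reflexive (coefficient-edge zero))
  coefficient-tail (suc n) = begin
    coefficient N (suc r′) * W′ (suc n) + fromℕ R (suc n) * fallingSum R W′ (λ d → coefficient N (suc d ℕ.+ suc r′)) n
      ≈⟨ +-cong (*-congʳ (reflexive (coefficient-edge (suc n))))
                (*-congˡ (fallingSum-zero R n W′ (λ d d≤n →
                  reflexive (coefficient-outside N _ (bound d d≤n) (s≤s (ℕ.m≤n+m (suc r′) d)))))) ⟩
    (y + fromℕ R (suc n)) * W′ (suc n) + fromℕ R (suc n) * 0#
      ≈⟨ trans (+-congˡ (zeroʳ _)) (+-identityʳ _) ⟩
    (y + fromℕ R (suc n)) * W′ (suc n) ∎
    where
    N = suc r′ ℕ.+ suc n
    bound : ∀ d → d ≤ n → suc d ℕ.+ suc r′ ≤ N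
    bound d d≤n = ℕ.≤-trans (ℕ.≤-reflexive (ℕ.+-comm (suc d) (suc r′))) (ℕ.+-monoʳ-≤ (suc r′) (s≤s d≤n))

  w≈coefficient : ∀ {N n c} → c ℕ.+ n ≡ N → c < suc r′ → w c ≈ coefficient N c
  w≈coefficient {N} {n} {c} c+n≡N c<1+r′ = reflexive (≡.trans (cycleWeight-short c c<1+r′)
    (≡.sym (coefficient-band N c (≡.subst (c ≤_) c+n≡N (ℕ.m≤m+n c n)) (ℕ.≤-pred c<1+r′))))

  recurrences-agree : ∀ N n c → c ℕ.+ n ≡ N → c ≤ suc r′ →
                      fallingSum R W′ (λ d → w (d ℕ.+ c)) n ≈ fallingSum R W′ (λ d → coefficient N (d ℕ.+ c)) n
  recurrences-agree N n c c+n≡N c≤1+r′ with ℕ.m≤n⇒m<n∨m≡n c≤1+r′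
  recurrences-agree _ n       _ ≡.refl _ | inj₂ ≡.refl = trans (fallingSum-tail n) (sym (coefficient-tail n))
  recurrences-agree N zero    c c+n≡N _ | inj₁ c<1+r′ = *-congʳ (w≈coefficient c+n≡N c<1+r′)
  recurrences-agree N (suc n) c c+n≡N _ | inj₁ c<1+r′ = +-cong (*-congʳ (w≈coefficient c+n≡N c<1+r′)) (*-congˡ (begin
    fallingSum R W′ (λ d → w (suc d ℕ.+ c)) n
      ≈⟨ fallingSum-cong R n (λ _ _ → refl) (λ d _ → reflexive (≡.cong w (≡.sym (ℕ.+-suc d c)))) ⟩
    fallingSum R W′ (λ d → w (d ℕ.+ suc c)) n
      ≈⟨ recurrences-agree N n (suc c) (≡.trans (≡.sym (ℕ.+-suc c n)) c+n≡N) c<1+r′ ⟩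
    fallingSum R W′ (λ d → coefficient N (d ℕ.+ suc c)) n
      ≈⟨ fallingSum-cong R n (λ _ _ → refl) (λ d _ → reflexive (≡.cong (coefficient N) (ℕ.+-suc d c))) ⟩
    fallingSum R W′ (λ d → coefficient N (suc d ℕ.+ c)) n ∎))

  V≈W : ∀ n → V R r n x y ≈ W′ n
  V≈W = <-rec (λ n → V R r n x y ≈ W′ n) step
    where
    step : ∀ n → (∀ {k} → k < n → V R r k x y ≈ W′ k) → V R r n x y ≈ W′ n
    step zero    _  = sym (trans (+-identityʳ _) (*-identityˡ _))
    step (suc N) ih = begin
      V R r (suc N) x y
        ≈⟨ V-suc-fallingSum N ⟩
      fallingSum R (λ k → V R r k x y) (coefficient N) N
        ≈⟨ fallingSum-cong R N (λ k k≤N → ih (s≤s k≤N)) (λ d _ → reflexive (≡.cong (coefficient N) (≡.sym (ℕ.+-identityʳ d)))) ⟩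
      fallingSum R W′ (λ d → coefficient N (d ℕ.+ 0)) N
        ≈⟨ recurrences-agree N N 0 ≡.refl z≤n ⟨
      fallingSum R W′ (λ d → w (d ℕ.+ 0)) N
        ≈⟨ fallingSum-cong R N (λ _ _ → refl) (λ d _ → reflexive (≡.cong w (ℕ.+-identityʳ d))) ⟩
      fallingSum R W′ w N
        ≈⟨ W-suc-fallingSum N ⟨
      W′ (suc N) ∎

mainTheorem5 : ∀ {c ℓ} (R : CommutativeRing c ℓ) (r : ℕ) → 2 ≤ r →
                 ∀ (n : ℕ) (x y : CommutativeRing.Carrier R) →
                 CommutativeRing._≈_ R (V R r n x y) (W R r n x y)
mainTheorem5 R (suc (suc r′)) (s≤s (s≤s z≤n)) n x y = V≈W R r′ x y n
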